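{- There is a family of first-order sequents $\{S_i\}_{i<\omega}$ together with ${\bf LK}$-proofs $\pi_i$ of $S_i$ (containing cuts) such that: (1) the size of $S_i$ is polynomial in $i$; (2) there is no bound on the size of the smallest cut-free ${\bf LK}$-proofs of $S_i$ that is elementary in $i$; (3) the size of $\pi_i$ is polynomially bounded in $i$; (4) $S_i$ contains only weak quantifiers; (5) for every cut formula $A$ of $\pi_i$, the formula $\forall \overline{x}(A^M\to A^M)$ occurs on the left side (antecedent) of $S_i$, where $\overline{x}$ are the free variables of $A^M$.
   Context: ${\bf LK}$ is Gentzen's classical first-order sequent calculus (with cut). The size of a sequent or proof is the number of symbol occurrences in it. A function on the natural numbers is elementary if it can be defined by a quantifier-free formula from $+$, $\times$ and $x\mapsto 2^x$. A quantifier occurrence in a sequent $\Gamma\vdash\Delta$ is strong if it is a universal quantifier occurring positively (in $\Delta$ with positive polarity or in $\Gamma$ with negative polarity, polarity flipped by negation and by the antecedent of an implication) or an existential quantifier occurring negatively; otherwise it is weak. The matrix $A^M$ of a first-order formula $A$ is obtained from $A$ by deleting all quantifiers and replacing the bound variables by free variables (e.g. $[\exists x(\forall y A(x,y)\lor B(x))]^M=A(a,b)\lor B(a)$). -}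

module Defs where

open import Data.Nat using (ℕ; zero; suc; _+_; _*_; _^_; _<_; _≤_; _⊔_; _≡ᵇ_)
open import Data.Bool using (Bool; true; false; if_then_else_)
open import Data.List using (List; []; _∷_; _++_; [_]; _∷ʳ_; foldr)
open import Data.List.Membership.Propositional using (_∈_; _∉_)
open import Data.Product using (Σ; _×_; _,_; proj₁)
open import Data.Unit using (⊤)
open import Data.Empty using (⊥)
open import Relation.Binary.PropositionalEquality using (_≡_)

-- First-order language (locally nameless).
-- Free variables: fvar a (a : ℕ); bound variables: de Bruijn bvar k.
-- Function symbols and predicate symbols are named by natural numbers
-- (a symbol is applied to a list of arguments; no equality symbol).

data Term : Set where
  fvar : ℕ → Term
  bvar : ℕ → Term
  fn   : ℕ → List Term → Term

infixr 9 _∧ᶠ_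
infixr 8 _∨ᶠ_
infixr 7 _⇒ᶠ_
infix 10 ¬ᶠ_

data Formula : Set where
  atom  : ℕ → List Term → Formula
  ¬ᶠ_   : Formula → Formula
  _∧ᶠ_  : Formula → Formula → Formula
  _∨ᶠ_  : Formula → Formula → Formula
  _⇒ᶠ_  : Formula → Formula → Formula
  ∀ᶠ    : Formula → Formula    -- binds bvar 0 in its body
  ∃ᶠ    : Formula → Formula    -- binds bvar 0 in its body

mutual
  WfT : ℕ → Term → Set
  WfT k (fvar _)  = ⊤
  WfT k (bvar j)  = j < k
  WfT k (fn _ ts) = WfTs k ts

  WfTs : ℕ → List Term → Set
  WfTs k []       = ⊤
  WfTs k (t ∷ ts) = WfT k t × WfTs k ts

WfF : ℕ → Formula → Set
WfF k (atom _ ts) = WfTs k ts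
WfF k (¬ᶠ A)      = WfF k A
WfF k (A ∧ᶠ B)    = WfF k A × WfF k B
WfF k (A ∨ᶠ B)    = WfF k A × WfF k B
WfF k (A ⇒ᶠ B)    = WfF k A × WfF k B
WfF k (∀ᶠ A)      = WfF (suc k) A
WfF k (∃ᶠ A)      = WfF (suc k) A

mutual
  fvT : Term → List ℕ
  fvT (fvar a)  = [ a ]
  fvT (bvar _)  = []
  fvT (fn _ ts) = fvTs ts

  fvTs : List Term → List ℕ
  fvTs []       = []
  fvTs (t ∷ ts) = fvT t ++ fvTs ts

fvF : Formula → List ℕ
fvF (atom _ ts) = fvTs ts
fvF (¬ᶠ A)      = fvF A
fvF (A ∧ᶠ B)    = fvF A ++ fvF B
fvF (A ∨ᶠ B)    = fvF A ++ fvF B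
fvF (A ⇒ᶠ B)    = fvF A ++ fvF B
fvF (∀ᶠ A)      = fvF A
fvF (∃ᶠ A)      = fvF A

fvFs : List Formula → List ℕ
fvFs []       = []
fvFs (A ∷ As) = fvF A ++ fvFs As

mutual
  openT : ℕ → Term → Term → Term
  openT k u (fvar a)  = fvar a
  openT k u (bvar j)  = if j ≡ᵇ k then u else bvar j
  openT k u (fn f ts) = fn f (openTs k u ts)

  openTs : ℕ → Term → List Term → List Term
  openTs k u []       = []
  openTs k u (t ∷ ts) = openT k u t ∷ openTs k u ts

openF : ℕ → Term → Formula → Formula
openF k u (atom P ts) = atom P (openTs k u ts)
openF k u (¬ᶠ A)      = ¬ᶠ openF k u A
openF k u (A ∧ᶠ B)    = openF k u A ∧ᶠ openF k u B
openF k u (A ∨ᶠ B)    = openF k u A ∨ᶠ openF k u B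
openF k u (A ⇒ᶠ B)    = openF k u A ⇒ᶠ openF k u B
openF k u (∀ᶠ A)      = ∀ᶠ (openF (suc k) u A)
openF k u (∃ᶠ A)      = ∃ᶠ (openF (suc k) u A)

inst : Formula → Term → Formula
inst A t = openF 0 t A

mutual
  closeT : ℕ → ℕ → Term → Term
  closeT k a (fvar b)  = if a ≡ᵇ b then bvar k else fvar b
  closeT k a (bvar j)  = bvar j
  closeT k a (fn f ts) = fn f (closeTs k a ts)

  closeTs : ℕ → ℕ → List Term → List Term
  closeTs k a []       = []
  closeTs k a (t ∷ ts) = closeT k a t ∷ closeTs k a ts

closeF : ℕ → ℕ → Formula → Formula
closeF k a (atom P ts) = atom P (closeTs k a ts)
closeF k a (¬ᶠ A)      = ¬ᶠ closeF k a A
closeF k a (A ∧ᶠ B)    = closeF k a A ∧ᶠ closeF k a B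
closeF k a (A ∨ᶠ B)    = closeF k a A ∨ᶠ closeF k a B
closeF k a (A ⇒ᶠ B)    = closeF k a A ⇒ᶠ closeF k a B
closeF k a (∀ᶠ A)      = ∀ᶠ (closeF (suc k) a A)
closeF k a (∃ᶠ A)      = ∃ᶠ (closeF (suc k) a A)

closeAll : List ℕ → Formula → Formula
closeAll []       B = B
closeAll (x ∷ xs) B = ∀ᶠ (closeF 0 x (closeAll xs B))

-- Matrix A^M: delete all quantifiers, replacing each bound variable by a
-- fresh free variable (distinct quantifier occurrences get distinct
-- variables, all different from the free variables of A).

lookupBV : List ℕ → ℕ → Term
lookupBV []       k       = bvar k
lookupBV (x ∷ xs) zero    = fvar x
lookupBV (x ∷ xs) (suc k) = lookupBV xs k

mutual
  matT : List ℕ → Term → Term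
  matT env (fvar a)  = fvar a
  matT env (bvar k)  = lookupBV env k
  matT env (fn f ts) = fn f (matTs env ts)

  matTs : List ℕ → List Term → List Term
  matTs env []       = []
  matTs env (t ∷ ts) = matT env t ∷ matTs env ts

-- env: fresh names for the enclosing binders; n: next unused fresh name
matF : List ℕ → ℕ → Formula → Formula × ℕ
matF env n (atom P ts) = atom P (matTs env ts) , n
matF env n (¬ᶠ A) with matF env n A
... | A' , n' = ¬ᶠ A' , n'
matF env n (A ∧ᶠ B) with matF env n A
... | A' , n₁ with matF env n₁ B
... | B' , n₂ = A' ∧ᶠ B' , n₂
matF env n (A ∨ᶠ B) with matF env n A
... | A' , n₁ with matF env n₁ B
... | B' , n₂ = A' ∨ᶠ B' , n₂
matF env n (A ⇒ᶠ B) with matF env n A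
... | A' , n₁ with matF env n₁ B
... | B' , n₂ = A' ⇒ᶠ B' , n₂
matF env n (∀ᶠ A) = matF (n ∷ env) (suc n) A
matF env n (∃ᶠ A) = matF (n ∷ env) (suc n) A

maxList : List ℕ → ℕ
maxList = foldr _⊔_ 0

matrix : Formula → Formula
matrix A = proj₁ (matF [] (suc (maxList (fvF A))) A)

-- Sizes (number of symbol occurrences)

mutual
  sizeT : Term → ℕ
  sizeT (fvar _)  = 1
  sizeT (bvar _)  = 1
  sizeT (fn _ ts) = suc (sizeTs ts)

  sizeTs : List Term → ℕ
  sizeTs []       = 0
  sizeTs (t ∷ ts) = sizeT t + sizeTs ts

sizeF : Formula → ℕ
sizeF (atom _ ts) = suc (sizeTs ts)
sizeF (¬ᶠ A)      = suc (sizeF A)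
sizeF (A ∧ᶠ B)    = suc (sizeF A + sizeF B)
sizeF (A ∨ᶠ B)    = suc (sizeF A + sizeF B)
sizeF (A ⇒ᶠ B)    = suc (sizeF A + sizeF B)
sizeF (∀ᶠ A)      = 2 + sizeF A    -- quantifier symbol and its variable
sizeF (∃ᶠ A)      = 2 + sizeF A

sizeFs : List Formula → ℕ
sizeFs []       = 0
sizeFs (A ∷ As) = sizeF A + sizeFs As

infix 3 _⊢_
data Seq : Set where
  _⊢_ : List Formula → List Formula → Seq

antecedent : Seq → List Formula
antecedent (Γ ⊢ Δ) = Γ

succedent : Seq → List Formula
succedent (Γ ⊢ Δ) = Δ

-- the turnstile counts as one symbol
sizeS : Seq → ℕ
sizeS (Γ ⊢ Δ) = suc (sizeFs Γ + sizeFs Δ)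

-- Sequents are sequences; left principal
-- formulas are placed first in the antecedent, right principal formulas
-- last in the succedent; exchange rules permute arbitrary adjacent pairs.

data Proof : Seq → Set where
  ax  : ∀ {A} → WfF 0 A → Proof ([ A ] ⊢ [ A ])
  wL  : ∀ {Γ Δ A} → WfF 0 A → Proof (Γ ⊢ Δ) → Proof (A ∷ Γ ⊢ Δ)
  wR  : ∀ {Γ Δ A} → WfF 0 A → Proof (Γ ⊢ Δ) → Proof (Γ ⊢ Δ ∷ʳ A)
  cL  : ∀ {Γ Δ A} → Proof (A ∷ A ∷ Γ ⊢ Δ) → Proof (A ∷ Γ ⊢ Δ)
  cR  : ∀ {Γ Δ A} → Proof (Γ ⊢ Δ ∷ʳ A ∷ʳ A) → Proof (Γ ⊢ Δ ∷ʳ A)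
  eL  : ∀ {Γ₁ Γ₂ Δ A B} → Proof (Γ₁ ++ A ∷ B ∷ Γ₂ ⊢ Δ) → Proof (Γ₁ ++ B ∷ A ∷ Γ₂ ⊢ Δ)
  eR  : ∀ {Γ Δ₁ Δ₂ A B} → Proof (Γ ⊢ Δ₁ ++ A ∷ B ∷ Δ₂) → Proof (Γ ⊢ Δ₁ ++ B ∷ A ∷ Δ₂)
  cut : ∀ {Γ Δ Π Λ A} → Proof (Γ ⊢ Δ ∷ʳ A) → Proof (A ∷ Π ⊢ Λ) → Proof (Γ ++ Π ⊢ Δ ++ Λ)
  ¬L  : ∀ {Γ Δ A} → Proof (Γ ⊢ Δ ∷ʳ A) → Proof (¬ᶠ A ∷ Γ ⊢ Δ)
  ¬R  : ∀ {Γ Δ A} → Proof (A ∷ Γ ⊢ Δ) → Proof (Γ ⊢ Δ ∷ʳ ¬ᶠ A)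
  ∧L₁ : ∀ {Γ Δ A B} → WfF 0 B → Proof (A ∷ Γ ⊢ Δ) → Proof (A ∧ᶠ B ∷ Γ ⊢ Δ)
  ∧L₂ : ∀ {Γ Δ A B} → WfF 0 A → Proof (B ∷ Γ ⊢ Δ) → Proof (A ∧ᶠ B ∷ Γ ⊢ Δ)
  ∧R  : ∀ {Γ Δ A B} → Proof (Γ ⊢ Δ ∷ʳ A) → Proof (Γ ⊢ Δ ∷ʳ B) → Proof (Γ ⊢ Δ ∷ʳ A ∧ᶠ B)
  ∨L  : ∀ {Γ Δ A B} → Proof (A ∷ Γ ⊢ Δ) → Proof (B ∷ Γ ⊢ Δ) → Proof (A ∨ᶠ B ∷ Γ ⊢ Δ)
  ∨R₁ : ∀ {Γ Δ A B} → WfF 0 B → Proof (Γ ⊢ Δ ∷ʳ A) → Proof (Γ ⊢ Δ ∷ʳ A ∨ᶠ B)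
  ∨R₂ : ∀ {Γ Δ A B} → WfF 0 A → Proof (Γ ⊢ Δ ∷ʳ B) → Proof (Γ ⊢ Δ ∷ʳ A ∨ᶠ B)
  ⇒L  : ∀ {Γ Δ Π Λ A B} → Proof (Γ ⊢ Δ ∷ʳ A) → Proof (B ∷ Π ⊢ Λ) → Proof (A ⇒ᶠ B ∷ Γ ++ Π ⊢ Δ ++ Λ)
  ⇒R  : ∀ {Γ Δ A B} → Proof (A ∷ Γ ⊢ Δ ∷ʳ B) → Proof (Γ ⊢ Δ ∷ʳ A ⇒ᶠ B)
  ∀L  : ∀ {Γ Δ A} (t : Term) → WfT 0 t → Proof (inst A t ∷ Γ ⊢ Δ) → Proof (∀ᶠ A ∷ Γ ⊢ Δ)
  ∀R  : ∀ {Γ Δ A} (a : ℕ) → a ∉ fvFs Γ → a ∉ fvFs Δ → a ∉ fvF A →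
        Proof (Γ ⊢ Δ ∷ʳ inst A (fvar a)) → Proof (Γ ⊢ Δ ∷ʳ ∀ᶠ A)
  ∃L  : ∀ {Γ Δ A} (a : ℕ) → a ∉ fvFs Γ → a ∉ fvFs Δ → a ∉ fvF A →
        Proof (inst A (fvar a) ∷ Γ ⊢ Δ) → Proof (∃ᶠ A ∷ Γ ⊢ Δ)
  ∃R  : ∀ {Γ Δ A} (t : Term) → WfT 0 t → Proof (Γ ⊢ Δ ∷ʳ inst A t) → Proof (Γ ⊢ Δ ∷ʳ ∃ᶠ A)

sizeP : ∀ {S} → Proof S → ℕ
sizeP {S} (ax _)          = sizeS S
sizeP {S} (wL _ p)        = sizeS S + sizeP p
sizeP {S} (wR _ p)        = sizeS S + sizeP p
sizeP {S} (cL p)          = sizeS S + sizeP p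
sizeP {S} (cR p)          = sizeS S + sizeP p
sizeP {S} (eL p)          = sizeS S + sizeP p
sizeP {S} (eR p)          = sizeS S + sizeP p
sizeP {S} (cut p q)       = sizeS S + sizeP p + sizeP q
sizeP {S} (¬L p)          = sizeS S + sizeP p
sizeP {S} (¬R p)          = sizeS S + sizeP p
sizeP {S} (∧L₁ _ p)       = sizeS S + sizeP p
sizeP {S} (∧L₂ _ p)       = sizeS S + sizeP p
sizeP {S} (∧R p q)        = sizeS S + sizeP p + sizeP q
sizeP {S} (∨L p q)        = sizeS S + sizeP p + sizeP q
sizeP {S} (∨R₁ _ p)       = sizeS S + sizeP p
sizeP {S} (∨R₂ _ p)       = sizeS S + sizeP p
sizeP {S} (⇒L p q)        = sizeS S + sizeP p + sizeP q
sizeP {S} (⇒R p)          = sizeS S + sizeP p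
sizeP {S} (∀L _ _ p)      = sizeS S + sizeP p
sizeP {S} (∀R _ _ _ _ p)  = sizeS S + sizeP p
sizeP {S} (∃L _ _ _ _ p)  = sizeS S + sizeP p
sizeP {S} (∃R _ _ p)      = sizeS S + sizeP p

cuts : ∀ {S} → Proof S → List Formula
cuts (ax _)          = []
cuts (wL _ p)        = cuts p
cuts (wR _ p)        = cuts p
cuts (cL p)          = cuts p
cuts (cR p)          = cuts p
cuts (eL p)          = cuts p
cuts (eR p)          = cuts p
cuts (cut {A = A} p q) = A ∷ (cuts p ++ cuts q)
cuts (¬L p)          = cuts p
cuts (¬R p)          = cuts p
cuts (∧L₁ _ p)       = cuts p
cuts (∧L₂ _ p)       = cuts p
cuts (∧R p q)        = cuts p ++ cuts q
cuts (∨L p q)        = cuts p ++ cuts q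
cuts (∨R₁ _ p)       = cuts p
cuts (∨R₂ _ p)       = cuts p
cuts (⇒L p q)        = cuts p ++ cuts q
cuts (⇒R p)          = cuts p
cuts (∀L _ _ p)      = cuts p
cuts (∀R _ _ _ _ p)  = cuts p
cuts (∃L _ _ _ _ p)  = cuts p
cuts (∃R _ _ p)      = cuts p

CutFree : ∀ {S} → Proof S → Set
CutFree p = cuts p ≡ []

-- Strong / weak quantifiers.  NoStrong pos A : A, occurring with
-- polarity pos (true = positive), contains no strong quantifier.

flip : Bool → Bool
flip true  = false
flip false = true

NoStrong : Bool → Formula → Set
NoStrong p (atom _ _) = ⊤
NoStrong p (¬ᶠ A)     = NoStrong (flip p) A
NoStrong p (A ∧ᶠ B)   = NoStrong p A × NoStrong p B
NoStrong p (A ∨ᶠ B)   = NoStrong p A × NoStrong p B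
NoStrong p (A ⇒ᶠ B)   = NoStrong (flip p) A × NoStrong p B
NoStrong true  (∀ᶠ A) = ⊥               -- positive ∀ is strong
NoStrong false (∀ᶠ A) = NoStrong false A
NoStrong true  (∃ᶠ A) = NoStrong true A
NoStrong false (∃ᶠ A) = ⊥               -- negative ∃ is strong

AllNoStrong : Bool → List Formula → Set
AllNoStrong p []       = ⊤
AllNoStrong p (A ∷ As) = NoStrong p A × AllNoStrong p As

-- antecedent formulas occur negatively, succedent formulas positively
OnlyWeak : Seq → Set
OnlyWeak (Γ ⊢ Δ) = AllNoStrong false Γ × AllNoStrong true Δ

-- Elementary bounds: terms in one variable built from numerals, +, ×
-- and x ↦ 2^x.

data ETerm : Set where
  x̂    : ETerm
  num  : ℕ → ETerm
  _⊕_  : ETerm → ETerm → ETerm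
  _⊗_  : ETerm → ETerm → ETerm
  two^ : ETerm → ETerm

evalE : ETerm → ℕ → ℕ
evalE x̂        i = i
evalE (num n)  i = n
evalE (e ⊕ f)  i = evalE e i + evalE f i
evalE (e ⊗ f)  i = evalE e i * evalE f i
evalE (two^ e) i = 2 ^ evalE e i

PolyBounded : (ℕ → ℕ) → Set
PolyBounded g = Σ ℕ λ k → ∀ i → g i ≤ k * suc i ^ k

-- Read E x y z as y + 2 ^ x = z.  From the two axioms for E, tame proofs
-- (cut-free, with quantifiers instantiated only by terms of size at most 2)
-- derive Level d 0 in height 39, and derive from Level d 0 in height O(d) that
-- a tower of d + 1 exponentials exists.  A tame proof is at most 5 ^ height
-- times larger than its end sequent, and Level d 0 has size O(2 ^ d), so one
-- cut on it gives proofs of size polynomial in i for d = ⌊log₂ (i + 1)⌋.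
--
-- Conversely, in a cut-free proof of size N of a sequent without strong
-- quantifiers every quantifier instantiation that matters uses a term of value
-- at most N, so the proof is sound for the model of y + 2 ^ x = z whose quantifiers
-- range over {0, …, N}.  The axioms and ∀x̄ (A ⇒ A) hold there, hence so does
-- the existence of the tower, which forces N to be at least a tower of
-- d + 1 exponentials: more than any elementary function of i.

{-# OPTIONS --safe #-}
module Submission where

open import Defs
open import Data.Nat using (ℕ; zero; suc; pred; NonZero; _+_; _*_; _^_; _<_; _≤_; _⊔_; _≡ᵇ_; _≤?_; z≤n; s≤s; ⌊_/2⌋)
open import Data.Nat.Induction using (<-wellFounded)
open import Data.Nat.Logarithm using (⌊log₂_⌋; ⌊log₂[2^n]⌋≡n)
open import Data.Nat.Logarithm.Core using (⌊log2⌋)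
open import Induction.WellFounded using (Acc; acc)
open import Data.Nat.Properties
open import Data.Nat.Tactic.RingSolver using (solve-∀)
open import Data.Bool using (Bool; true; false; T; T?; _∧_; _∨_; not)
open import Data.Bool.Properties using (T-∧; T-∨)
open import Data.List using (List; []; _∷_; _++_; [_]; _∷ʳ_; length; upTo; deduplicate)
open import Data.Bool.ListAction using (all; any; and; or)
open import Data.List.Properties using (++-identityʳ; length-++; map-cong; ++-conicalˡ; ++-conicalʳ; length-deduplicate)
open import Data.List.Membership.Propositional using (_∈_; _∉_; find; lose)
open import Data.List.Membership.Propositional.Properties using (∈-++⁻; ∈-upTo⁺; ∈-upTo⁻)
open import Data.List.Membership.DecPropositional _≟_ using (_∈?_)
open import Data.List.Relation.Unary.Unique.Propositional using (Unique)
open import Data.List.Relation.Unary.Unique.DecPropositional.Properties _≟_ using (deduplicate-!)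
open import Data.List.Relation.Unary.All as All using (All; []; _∷_)
open import Data.List.Relation.Unary.All.Properties as AllP using (all⁺; all⁻)
open import Data.List.Relation.Unary.Any using (Any; here; there)
open import Data.List.Relation.Unary.Any.Properties as AnyP using (any⁺; any⁻)
open import Data.List.Relation.Binary.Permutation.Propositional using (_↭_; ↭-refl; ↭-swap)
open import Data.List.Relation.Binary.Permutation.Propositional.Properties
  using (All-resp-↭; Any-resp-↭) renaming (++⁺ˡ to ↭-++⁺ˡ)
open import Data.Product using (Σ; _×_; _,_; proj₁; proj₂)
open import Data.Sum using (_⊎_; inj₁; inj₂; [_,_]′)
open import Data.Unit using (⊤; tt)
open import Data.Empty using (⊥; ⊥-elim)
open import Relation.Nullary using (¬_; yes; no)
open import Relation.Nullary.Decidable using (True; False; toWitness; toWitnessFalse)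
open import Function using (_∘_; id)
open import Function.Bundles using (_⇔_; mk⇔; Equivalence)
open import Relation.Binary.PropositionalEquality hiding ([_])

+-exchange : ∀ a b c → a + (b + c) ≡ b + (a + c)
+-exchange = solve-∀

sizeFs-++ : ∀ Γ Δ → sizeFs (Γ ++ Δ) ≡ sizeFs Γ + sizeFs Δ
sizeFs-++ []      Δ = refl
sizeFs-++ (A ∷ Γ) Δ = trans (cong (sizeF A +_) (sizeFs-++ Γ Δ)) (sym (+-assoc (sizeF A) (sizeFs Γ) (sizeFs Δ)))

∉-++ : ∀ {a : ℕ} xs {ys} → a ∉ xs → a ∉ ys → a ∉ xs ++ ys
∉-++ xs a∉xs a∉ys a∈ with ∈-++⁻ xs a∈
... | inj₁ a∈xs = a∉xs a∈xs
... | inj₂ a∈ys = a∉ys a∈ys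

mutual
  shiftT : Term → Term
  shiftT (fvar a)  = fvar a
  shiftT (bvar j)  = bvar (suc j)
  shiftT (fn g ts) = fn g (shiftTs ts)

  shiftTs : List Term → List Term
  shiftTs []       = []
  shiftTs (t ∷ ts) = shiftT t ∷ shiftTs ts

mutual
  openT-shiftT : ∀ j u t → shiftT u ≡ u → openT (suc j) u (shiftT t) ≡ shiftT (openT j u t)
  openT-shiftT j u (fvar a)  u↑ = refl
  openT-shiftT j u (bvar i)  u↑ with i ≡ᵇ j
  ... | true  = sym u↑
  ... | false = refl
  openT-shiftT j u (fn g ts) u↑ = cong (fn g) (openTs-shiftTs j u ts u↑)

  openTs-shiftTs : ∀ j u ts → shiftT u ≡ u → openTs (suc j) u (shiftTs ts) ≡ shiftTs (openTs j u ts)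
  openTs-shiftTs j u []       u↑ = refl
  openTs-shiftTs j u (t ∷ ts) u↑ = cong₂ _∷_ (openT-shiftT j u t u↑) (openTs-shiftTs j u ts u↑)

openT-shiftT² : ∀ j u t → shiftT u ≡ u → openT (suc (suc j)) u (shiftT (shiftT t)) ≡ shiftT (shiftT (openT j u t))
openT-shiftT² j u t u↑ = trans (openT-shiftT (suc j) u (shiftT t) u↑) (cong shiftT (openT-shiftT j u t u↑))

mutual
  fvT-shiftT : ∀ t → fvT (shiftT t) ≡ fvT t
  fvT-shiftT (fvar a)  = refl
  fvT-shiftT (bvar j)  = refl
  fvT-shiftT (fn g ts) = fvTs-shiftTs ts

  fvTs-shiftTs : ∀ ts → fvTs (shiftTs ts) ≡ fvTs ts
  fvTs-shiftTs []       = refl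
  fvTs-shiftTs (t ∷ ts) = cong₂ _++_ (fvT-shiftT t) (fvTs-shiftTs ts)

mutual
  sizeT-shiftT : ∀ t → sizeT (shiftT t) ≡ sizeT t
  sizeT-shiftT (fvar a)  = refl
  sizeT-shiftT (bvar j)  = refl
  sizeT-shiftT (fn g ts) = cong suc (sizeTs-shiftTs ts)

  sizeTs-shiftTs : ∀ ts → sizeTs (shiftTs ts) ≡ sizeTs ts
  sizeTs-shiftTs []       = refl
  sizeTs-shiftTs (t ∷ ts) = cong₂ _+_ (sizeT-shiftT t) (sizeTs-shiftTs ts)

mutual
  WfT-shiftT : ∀ k t → WfT k t → WfT (suc k) (shiftT t)
  WfT-shiftT k (fvar a)  _ = tt
  WfT-shiftT k (bvar j)  j<k = s≤s j<k
  WfT-shiftT k (fn g ts) wf = WfTs-shiftTs k ts wf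

  WfTs-shiftTs : ∀ k ts → WfTs k ts → WfTs (suc k) (shiftTs ts)
  WfTs-shiftTs k []       _ = tt
  WfTs-shiftTs k (t ∷ ts) (wf , wfs) = WfT-shiftT k t wf , WfTs-shiftTs k ts wfs

mutual
  shiftT-closed : ∀ t → WfT 0 t → shiftT t ≡ t
  shiftT-closed (fvar a)  _  = refl
  shiftT-closed (fn g ts) wf = cong (fn g) (shiftTs-closed ts wf)

  shiftTs-closed : ∀ ts → WfTs 0 ts → shiftTs ts ≡ ts
  shiftTs-closed []       _          = refl
  shiftTs-closed (t ∷ ts) (wf , wfs) = cong₂ _∷_ (shiftT-closed t wf) (shiftTs-closed ts wfs)

mutual
  openT-closed : ∀ k u t → WfT 0 t → openT k u t ≡ t
  openT-closed k u (fvar a)  _  = refl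
  openT-closed k u (fn g ts) wf = cong (fn g) (openTs-closed k u ts wf)

  openTs-closed : ∀ k u ts → WfTs 0 ts → openTs k u ts ≡ ts
  openTs-closed k u []       _          = refl
  openTs-closed k u (t ∷ ts) (wf , wfs) = cong₂ _∷_ (openT-closed k u t wf) (openTs-closed k u ts wfs)

1≤sizeT : ∀ t → 1 ≤ sizeT t
1≤sizeT (fvar _)  = s≤s z≤n
1≤sizeT (bvar _)  = s≤s z≤n
1≤sizeT (fn _ _)  = s≤s z≤n

private
  suc-≤-* : ∀ {s x a} → 1 ≤ s → x ≤ a * s → suc x ≤ suc a * s
  suc-≤-* 1≤s x≤ = +-mono-≤ 1≤s x≤

  +-≤-* : ∀ {s x y a b} → x ≤ a * s → y ≤ b * s → x + y ≤ (a + b) * s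
  +-≤-* {s} {a = a} {b} x≤ y≤ = ≤-trans (+-mono-≤ x≤ y≤) (≤-reflexive (sym (*-distribʳ-+ s a b)))

mutual
  sizeT-openT : ∀ k u t → sizeT (openT k u t) ≤ sizeT t * sizeT u
  sizeT-openT k u (fvar a)  = ≤-trans (1≤sizeT u) (≤-reflexive (sym (+-identityʳ (sizeT u))))
  sizeT-openT k u (bvar j) with j ≡ᵇ k
  ... | true  = ≤-reflexive (sym (+-identityʳ (sizeT u)))
  ... | false = ≤-trans (1≤sizeT u) (≤-reflexive (sym (+-identityʳ (sizeT u))))
  sizeT-openT k u (fn g ts) = suc-≤-* {a = sizeTs ts} (1≤sizeT u) (sizeTs-openTs k u ts)

  sizeTs-openTs : ∀ k u ts → sizeTs (openTs k u ts) ≤ sizeTs ts * sizeT u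
  sizeTs-openTs k u []       = z≤n
  sizeTs-openTs k u (t ∷ ts) = +-≤-* {a = sizeT t} (sizeT-openT k u t) (sizeTs-openTs k u ts)

sizeF-openF : ∀ k u A → sizeF (openF k u A) ≤ sizeF A * sizeT u
sizeF-openF k u (atom P ts) = suc-≤-* {a = sizeTs ts} (1≤sizeT u) (sizeTs-openTs k u ts)
sizeF-openF k u (¬ᶠ A)      = suc-≤-* {a = sizeF A} (1≤sizeT u) (sizeF-openF k u A)
sizeF-openF k u (A ∧ᶠ B)    = suc-≤-* {a = sizeF A + sizeF B} (1≤sizeT u)
                                (+-≤-* {a = sizeF A} (sizeF-openF k u A) (sizeF-openF k u B))
sizeF-openF k u (A ∨ᶠ B)    = suc-≤-* {a = sizeF A + sizeF B} (1≤sizeT u)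
                                (+-≤-* {a = sizeF A} (sizeF-openF k u A) (sizeF-openF k u B))
sizeF-openF k u (A ⇒ᶠ B)    = suc-≤-* {a = sizeF A + sizeF B} (1≤sizeT u)
                                (+-≤-* {a = sizeF A} (sizeF-openF k u A) (sizeF-openF k u B))
sizeF-openF k u (∀ᶠ A)      = suc-≤-* {a = suc (sizeF A)} (1≤sizeT u)
                                (suc-≤-* {a = sizeF A} (1≤sizeT u) (sizeF-openF (suc k) u A))
sizeF-openF k u (∃ᶠ A)      = suc-≤-* {a = suc (sizeF A)} (1≤sizeT u)
                                (suc-≤-* {a = sizeF A} (1≤sizeT u) (sizeF-openF (suc k) u A))

sizeF-inst≤2* : ∀ A t → sizeT t ≤ 2 → sizeF (inst A t) ≤ 2 * sizeF A
sizeF-inst≤2* A t t≤2 = ≤-trans (sizeF-openF 0 t A) (≤-trans (*-monoʳ-≤ (sizeF A) t≤2) (≤-reflexive (*-comm (sizeF A) 2)))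

NoStrong-openF : ∀ p A k u → NoStrong p A → NoStrong p (openF k u A)
NoStrong-openF p     (atom _ _) k u ns         = tt
NoStrong-openF p     (¬ᶠ A)     k u ns         = NoStrong-openF (flip p) A k u ns
NoStrong-openF p     (A ∧ᶠ B)   k u (nsA , nsB) = NoStrong-openF p A k u nsA , NoStrong-openF p B k u nsB
NoStrong-openF p     (A ∨ᶠ B)   k u (nsA , nsB) = NoStrong-openF p A k u nsA , NoStrong-openF p B k u nsB
NoStrong-openF p     (A ⇒ᶠ B)   k u (nsA , nsB) = NoStrong-openF (flip p) A k u nsA , NoStrong-openF p B k u nsB
NoStrong-openF false (∀ᶠ A)     k u ns         = NoStrong-openF false A (suc k) u ns
NoStrong-openF true  (∃ᶠ A)     k u ns         = NoStrong-openF true A (suc k) u ns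

mutual
  sizeT-closeT : ∀ k a t → sizeT (closeT k a t) ≡ sizeT t
  sizeT-closeT k a (fvar b) with a ≡ᵇ b
  ... | true  = refl
  ... | false = refl
  sizeT-closeT k a (bvar j)  = refl
  sizeT-closeT k a (fn g ts) = cong suc (sizeTs-closeTs k a ts)

  sizeTs-closeTs : ∀ k a ts → sizeTs (closeTs k a ts) ≡ sizeTs ts
  sizeTs-closeTs k a []       = refl
  sizeTs-closeTs k a (t ∷ ts) = cong₂ _+_ (sizeT-closeT k a t) (sizeTs-closeTs k a ts)

sizeF-closeF : ∀ k a A → sizeF (closeF k a A) ≡ sizeF A
sizeF-closeF k a (atom P ts) = cong suc (sizeTs-closeTs k a ts)
sizeF-closeF k a (¬ᶠ A)      = cong suc (sizeF-closeF k a A)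
sizeF-closeF k a (A ∧ᶠ B)    = cong suc (cong₂ _+_ (sizeF-closeF k a A) (sizeF-closeF k a B))
sizeF-closeF k a (A ∨ᶠ B)    = cong suc (cong₂ _+_ (sizeF-closeF k a A) (sizeF-closeF k a B))
sizeF-closeF k a (A ⇒ᶠ B)    = cong suc (cong₂ _+_ (sizeF-closeF k a A) (sizeF-closeF k a B))
sizeF-closeF k a (∀ᶠ A)      = cong (2 +_) (sizeF-closeF (suc k) a A)
sizeF-closeF k a (∃ᶠ A)      = cong (2 +_) (sizeF-closeF (suc k) a A)

mutual
  WfT-closeT : ∀ k a t → WfT k t → WfT (suc k) (closeT k a t)
  WfT-closeT k a (fvar b) _ with a ≡ᵇ b
  ... | true  = ≤-refl
  ... | false = tt
  WfT-closeT k a (bvar j)  j<k = m≤n⇒m≤1+n j<k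
  WfT-closeT k a (fn g ts) wf  = WfTs-closeTs k a ts wf

  WfTs-closeTs : ∀ k a ts → WfTs k ts → WfTs (suc k) (closeTs k a ts)
  WfTs-closeTs k a []       _          = tt
  WfTs-closeTs k a (t ∷ ts) (wf , wfs) = WfT-closeT k a t wf , WfTs-closeTs k a ts wfs

WfF-closeF : ∀ k a A → WfF k A → WfF (suc k) (closeF k a A)
WfF-closeF k a (atom P ts) wf         = WfTs-closeTs k a ts wf
WfF-closeF k a (¬ᶠ A)      wf         = WfF-closeF k a A wf
WfF-closeF k a (A ∧ᶠ B)    (wA , wB)  = WfF-closeF k a A wA , WfF-closeF k a B wB
WfF-closeF k a (A ∨ᶠ B)    (wA , wB)  = WfF-closeF k a A wA , WfF-closeF k a B wB
WfF-closeF k a (A ⇒ᶠ B)    (wA , wB)  = WfF-closeF k a A wA , WfF-closeF k a B wB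
WfF-closeF k a (∀ᶠ A)      wf         = WfF-closeF (suc k) a A wf
WfF-closeF k a (∃ᶠ A)      wf         = WfF-closeF (suc k) a A wf

NoStrong-closeF : ∀ p k a A → NoStrong p A → NoStrong p (closeF k a A)
NoStrong-closeF p     k a (atom _ _) ns          = tt
NoStrong-closeF p     k a (¬ᶠ A)     ns          = NoStrong-closeF (flip p) k a A ns
NoStrong-closeF p     k a (A ∧ᶠ B)   (nsA , nsB) = NoStrong-closeF p k a A nsA , NoStrong-closeF p k a B nsB
NoStrong-closeF p     k a (A ∨ᶠ B)   (nsA , nsB) = NoStrong-closeF p k a A nsA , NoStrong-closeF p k a B nsB
NoStrong-closeF p     k a (A ⇒ᶠ B)   (nsA , nsB) = NoStrong-closeF (flip p) k a A nsA , NoStrong-closeF p k a B nsB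
NoStrong-closeF false k a (∀ᶠ A)     ns          = NoStrong-closeF false (suc k) a A ns
NoStrong-closeF true  k a (∃ᶠ A)     ns          = NoStrong-closeF true (suc k) a A ns

sizeF-closeAll : ∀ xs B → sizeF (closeAll xs B) ≡ 2 * length xs + sizeF B
sizeF-closeAll []       B = refl
sizeF-closeAll (x ∷ xs) B = begin
  2 + sizeF (closeF 0 x (closeAll xs B)) ≡⟨ cong (2 +_) (sizeF-closeF 0 x (closeAll xs B)) ⟩
  2 + sizeF (closeAll xs B)              ≡⟨ cong (2 +_) (sizeF-closeAll xs B) ⟩
  2 + (2 * length xs + sizeF B)          ≡⟨ sym (+-assoc 2 (2 * length xs) (sizeF B)) ⟩
  2 + 2 * length xs + sizeF B            ≡⟨ cong (_+ sizeF B) (sym (*-suc 2 (length xs))) ⟩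
  2 * suc (length xs) + sizeF B          ∎
  where open ≡-Reasoning

WfF-closeAll : ∀ xs B → WfF 0 B → WfF 0 (closeAll xs B)
WfF-closeAll []       B wf = wf
WfF-closeAll (x ∷ xs) B wf = WfF-closeF 0 x (closeAll xs B) (WfF-closeAll xs B wf)

NoStrong-closeAll : ∀ xs B → NoStrong false B → NoStrong false (closeAll xs B)
NoStrong-closeAll []       B ns = ns
NoStrong-closeAll (x ∷ xs) B ns = NoStrong-closeF false 0 x (closeAll xs B) (NoStrong-closeAll xs B ns)

QuantifierFree : Formula → Set
QuantifierFree (atom _ _) = ⊤
QuantifierFree (¬ᶠ A)     = QuantifierFree A
QuantifierFree (A ∧ᶠ B)   = QuantifierFree A × QuantifierFree B
QuantifierFree (A ∨ᶠ B)   = QuantifierFree A × QuantifierFree B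
QuantifierFree (A ⇒ᶠ B)   = QuantifierFree A × QuantifierFree B
QuantifierFree (∀ᶠ A)     = ⊥
QuantifierFree (∃ᶠ A)     = ⊥

QuantifierFree⇒NoStrong : ∀ p A → QuantifierFree A → NoStrong p A
QuantifierFree⇒NoStrong p (atom _ _) _           = tt
QuantifierFree⇒NoStrong p (¬ᶠ A)     qf          = QuantifierFree⇒NoStrong (flip p) A qf
QuantifierFree⇒NoStrong p (A ∧ᶠ B)   (qfA , qfB) = QuantifierFree⇒NoStrong p A qfA , QuantifierFree⇒NoStrong p B qfB
QuantifierFree⇒NoStrong p (A ∨ᶠ B)   (qfA , qfB) = QuantifierFree⇒NoStrong p A qfA , QuantifierFree⇒NoStrong p B qfB
QuantifierFree⇒NoStrong p (A ⇒ᶠ B)   (qfA , qfB) = QuantifierFree⇒NoStrong (flip p) A qfA , QuantifierFree⇒NoStrong p B qfB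

lookupBV-closed : ∀ env k → k < length env → WfT 0 (lookupBV env k)
lookupBV-closed (x ∷ env) zero    _         = tt
lookupBV-closed (x ∷ env) (suc k) (s≤s k<) = lookupBV-closed env k k<

sizeT-lookupBV : ∀ env k → sizeT (lookupBV env k) ≡ 1
sizeT-lookupBV []        k       = refl
sizeT-lookupBV (x ∷ env) zero    = refl
sizeT-lookupBV (x ∷ env) (suc k) = sizeT-lookupBV env k

mutual
  WfT-matT : ∀ env t → WfT (length env) t → WfT 0 (matT env t)
  WfT-matT env (fvar a)  _  = tt
  WfT-matT env (bvar k)  k< = lookupBV-closed env k k<
  WfT-matT env (fn g ts) wf = WfTs-matTs env ts wf

  WfTs-matTs : ∀ env ts → WfTs (length env) ts → WfTs 0 (matTs env ts)
  WfTs-matTs env []       _          = tt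
  WfTs-matTs env (t ∷ ts) (wf , wfs) = WfT-matT env t wf , WfTs-matTs env ts wfs

mutual
  sizeT-matT : ∀ env t → sizeT (matT env t) ≡ sizeT t
  sizeT-matT env (fvar a)  = refl
  sizeT-matT env (bvar k)  = sizeT-lookupBV env k
  sizeT-matT env (fn g ts) = cong suc (sizeTs-matTs env ts)

  sizeTs-matTs : ∀ env ts → sizeTs (matTs env ts) ≡ sizeTs ts
  sizeTs-matTs env []       = refl
  sizeTs-matTs env (t ∷ ts) = cong₂ _+_ (sizeT-matT env t) (sizeTs-matTs env ts)

MatrixOf : List ℕ → Formula → Formula → Set
MatrixOf env A A′ = QuantifierFree A′ × sizeF A′ ≤ sizeF A × (WfF (length env) A → WfF 0 A′)

matF-MatrixOf : ∀ env n A → MatrixOf env A (proj₁ (matF env n A))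
matF-MatrixOf env n (atom P ts) = tt , ≤-reflexive (cong suc (sizeTs-matTs env ts)) , WfTs-matTs env ts
matF-MatrixOf env n (¬ᶠ A) with matF env n A | matF-MatrixOf env n A
... | _ , _ | qf , A′≤ , wf = qf , s≤s A′≤ , wf
matF-MatrixOf env n (A ∧ᶠ B) with matF env n A | matF-MatrixOf env n A
... | _ , n₁ | qfA , A′≤ , wfA with matF env n₁ B | matF-MatrixOf env n₁ B
...   | _ , _ | qfB , B′≤ , wfB = (qfA , qfB) , s≤s (+-mono-≤ A′≤ B′≤) , λ (a , b) → wfA a , wfB b
matF-MatrixOf env n (A ∨ᶠ B) with matF env n A | matF-MatrixOf env n A
... | _ , n₁ | qfA , A′≤ , wfA with matF env n₁ B | matF-MatrixOf env n₁ B
...   | _ , _ | qfB , B′≤ , wfB = (qfA , qfB) , s≤s (+-mono-≤ A′≤ B′≤) , λ (a , b) → wfA a , wfB b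
matF-MatrixOf env n (A ⇒ᶠ B) with matF env n A | matF-MatrixOf env n A
... | _ , n₁ | qfA , A′≤ , wfA with matF env n₁ B | matF-MatrixOf env n₁ B
...   | _ , _ | qfB , B′≤ , wfB = (qfA , qfB) , s≤s (+-mono-≤ A′≤ B′≤) , λ (a , b) → wfA a , wfB b
matF-MatrixOf env n (∀ᶠ A) with matF-MatrixOf (n ∷ env) (suc n) A
... | qf , A′≤ , wf = qf , m≤n⇒m≤1+n (m≤n⇒m≤1+n A′≤) , wf
matF-MatrixOf env n (∃ᶠ A) with matF-MatrixOf (n ∷ env) (suc n) A
... | qf , A′≤ , wf = qf , m≤n⇒m≤1+n (m≤n⇒m≤1+n A′≤) , wf

matrix-MatrixOf : ∀ A → MatrixOf [] A (matrix A)
matrix-MatrixOf A = matF-MatrixOf [] (suc (maxList (fvF A))) A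

mutual
  length-fvT : ∀ t → length (fvT t) ≤ sizeT t
  length-fvT (fvar a)  = ≤-refl
  length-fvT (bvar j)  = z≤n
  length-fvT (fn g ts) = m≤n⇒m≤1+n (length-fvTs ts)

  length-fvTs : ∀ ts → length (fvTs ts) ≤ sizeTs ts
  length-fvTs []       = z≤n
  length-fvTs (t ∷ ts) = ≤-trans (≤-reflexive (length-++ (fvT t))) (+-mono-≤ (length-fvT t) (length-fvTs ts))

length-fvF : ∀ A → length (fvF A) ≤ sizeF A
length-fvF (atom P ts) = m≤n⇒m≤1+n (length-fvTs ts)
length-fvF (¬ᶠ A)      = m≤n⇒m≤1+n (length-fvF A)
length-fvF (A ∧ᶠ B)    = m≤n⇒m≤1+n (≤-trans (≤-reflexive (length-++ (fvF A))) (+-mono-≤ (length-fvF A) (length-fvF B)))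
length-fvF (A ∨ᶠ B)    = m≤n⇒m≤1+n (≤-trans (≤-reflexive (length-++ (fvF A))) (+-mono-≤ (length-fvF A) (length-fvF B)))
length-fvF (A ⇒ᶠ B)    = m≤n⇒m≤1+n (≤-trans (≤-reflexive (length-++ (fvF A))) (+-mono-≤ (length-fvF A) (length-fvF B)))
length-fvF (∀ᶠ A)      = m≤n⇒m≤1+n (m≤n⇒m≤1+n (length-fvF A))
length-fvF (∃ᶠ A)      = m≤n⇒m≤1+n (m≤n⇒m≤1+n (length-fvF A))

-- Sizes of tame proofs

sizeFs-∷ʳ : ∀ Δ A → sizeFs (Δ ∷ʳ A) ≡ sizeFs Δ + sizeF A
sizeFs-∷ʳ Δ A = trans (sizeFs-++ Δ [ A ]) (cong (sizeFs Δ +_) (+-identityʳ (sizeF A)))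

sizeFs-swap : ∀ Γ₁ A B Γ₂ → sizeFs (Γ₁ ++ A ∷ B ∷ Γ₂) ≡ sizeFs (Γ₁ ++ B ∷ A ∷ Γ₂)
sizeFs-swap Γ₁ A B Γ₂ = begin
  sizeFs (Γ₁ ++ A ∷ B ∷ Γ₂)              ≡⟨ sizeFs-++ Γ₁ (A ∷ B ∷ Γ₂) ⟩
  sizeFs Γ₁ + (sizeF A + (sizeF B + s₂)) ≡⟨ cong (sizeFs Γ₁ +_) (+-exchange (sizeF A) (sizeF B) s₂) ⟩
  sizeFs Γ₁ + (sizeF B + (sizeF A + s₂)) ≡⟨ sizeFs-++ Γ₁ (B ∷ A ∷ Γ₂) ⟨
  sizeFs (Γ₁ ++ B ∷ A ∷ Γ₂)              ∎
  where open ≡-Reasoning; s₂ = sizeFs Γ₂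

sizeS-∷ : ∀ A Γ Δ → sizeS (A ∷ Γ ⊢ Δ) ≡ sizeF A + sizeS (Γ ⊢ Δ)
sizeS-∷ A Γ Δ = trans (cong suc (+-assoc (sizeF A) (sizeFs Γ) (sizeFs Δ))) (sym (+-suc (sizeF A) _))

sizeS-∷ʳ : ∀ Γ Δ A → sizeS (Γ ⊢ Δ ∷ʳ A) ≡ sizeF A + sizeS (Γ ⊢ Δ)
sizeS-∷ʳ Γ Δ A = begin
  suc (sizeFs Γ + sizeFs (Δ ∷ʳ A))       ≡⟨ cong (λ x → suc (sizeFs Γ + x)) (sizeFs-∷ʳ Δ A) ⟩
  suc (sizeFs Γ + (sizeFs Δ + sizeF A))  ≡⟨ cong suc (sym (+-assoc (sizeFs Γ) (sizeFs Δ) (sizeF A))) ⟩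
  suc (sizeFs Γ + sizeFs Δ + sizeF A)    ≡⟨ cong suc (+-comm _ (sizeF A)) ⟩
  suc (sizeF A + (sizeFs Γ + sizeFs Δ))  ≡⟨ +-suc (sizeF A) _ ⟨
  sizeF A + sizeS (Γ ⊢ Δ)                ∎
  where open ≡-Reasoning

sizeS-++ˡ : ∀ Γ Π Δ Λ → sizeS (Γ ⊢ Δ) ≤ sizeS (Γ ++ Π ⊢ Δ ++ Λ)
sizeS-++ˡ Γ Π Δ Λ rewrite sizeFs-++ Γ Π | sizeFs-++ Δ Λ =
  s≤s (+-mono-≤ (m≤m+n (sizeFs Γ) (sizeFs Π)) (m≤m+n (sizeFs Δ) (sizeFs Λ)))

sizeS-++ʳ : ∀ Γ Π Δ Λ → sizeS (Π ⊢ Λ) ≤ sizeS (Γ ++ Π ⊢ Δ ++ Λ)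
sizeS-++ʳ Γ Π Δ Λ rewrite sizeFs-++ Γ Π | sizeFs-++ Δ Λ =
  s≤s (+-mono-≤ (m≤n+m (sizeFs Π) (sizeFs Γ)) (m≤n+m (sizeFs Λ) (sizeFs Δ)))

height : ∀ {S} → Proof S → ℕ
height (ax _)          = 0
height (wL _ p)        = suc (height p)
height (wR _ p)        = suc (height p)
height (cL p)          = suc (height p)
height (cR p)          = suc (height p)
height (eL p)          = suc (height p)
height (eR p)          = suc (height p)
height (cut p q)       = suc (height p ⊔ height q)
height (¬L p)          = suc (height p)
height (¬R p)          = suc (height p)
height (∧L₁ _ p)       = suc (height p)
height (∧L₂ _ p)       = suc (height p)
height (∧R p q)        = suc (height p ⊔ height q)
height (∨L p q)        = suc (height p ⊔ height q)
height (∨R₁ _ p)       = suc (height p)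
height (∨R₂ _ p)       = suc (height p)
height (⇒L p q)        = suc (height p ⊔ height q)
height (⇒R p)          = suc (height p)
height (∀L _ _ p)      = suc (height p)
height (∀R _ _ _ _ p)  = suc (height p)
height (∃L _ _ _ _ p)  = suc (height p)
height (∃R _ _ p)      = suc (height p)

-- In a tame proof no premise is more than twice as large as its conclusion.
Tame : ∀ {S} → Proof S → Set
Tame (ax _)          = ⊤
Tame (wL _ p)        = Tame p
Tame (wR _ p)        = Tame p
Tame (cL p)          = Tame p
Tame (cR p)          = Tame p
Tame (eL p)          = Tame p
Tame (eR p)          = Tame p
Tame (cut p q)       = ⊥
Tame (¬L p)          = Tame p
Tame (¬R p)          = Tame p
Tame (∧L₁ _ p)       = Tame p
Tame (∧L₂ _ p)       = Tame p
Tame (∧R p q)        = Tame p × Tame q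
Tame (∨L p q)        = Tame p × Tame q
Tame (∨R₁ _ p)       = Tame p
Tame (∨R₂ _ p)       = Tame p
Tame (⇒L p q)        = Tame p × Tame q
Tame (⇒R p)          = Tame p
Tame (∀L t _ p)      = sizeT t ≤ 2 × Tame p
Tame (∀R _ _ _ _ p)  = Tame p
Tame (∃L _ _ _ _ p)  = Tame p
Tame (∃R t _ p)      = sizeT t ≤ 2 × Tame p

Tame⇒CutFree : ∀ {S} (p : Proof S) → Tame p → CutFree p
Tame⇒CutFree (ax _)         _         = refl
Tame⇒CutFree (wL _ p)       tp        = Tame⇒CutFree p tp
Tame⇒CutFree (wR _ p)       tp        = Tame⇒CutFree p tp
Tame⇒CutFree (cL p)         tp        = Tame⇒CutFree p tp
Tame⇒CutFree (cR p)         tp        = Tame⇒CutFree p tp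
Tame⇒CutFree (eL p)         tp        = Tame⇒CutFree p tp
Tame⇒CutFree (eR p)         tp        = Tame⇒CutFree p tp
Tame⇒CutFree (¬L p)         tp        = Tame⇒CutFree p tp
Tame⇒CutFree (¬R p)         tp        = Tame⇒CutFree p tp
Tame⇒CutFree (∧L₁ _ p)      tp        = Tame⇒CutFree p tp
Tame⇒CutFree (∧L₂ _ p)      tp        = Tame⇒CutFree p tp
Tame⇒CutFree (∧R p q)       (tp , tq) = cong₂ _++_ (Tame⇒CutFree p tp) (Tame⇒CutFree q tq)
Tame⇒CutFree (∨L p q)       (tp , tq) = cong₂ _++_ (Tame⇒CutFree p tp) (Tame⇒CutFree q tq)
Tame⇒CutFree (∨R₁ _ p)      tp        = Tame⇒CutFree p tp
Tame⇒CutFree (∨R₂ _ p)      tp        = Tame⇒CutFree p tp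
Tame⇒CutFree (⇒L p q)       (tp , tq) = cong₂ _++_ (Tame⇒CutFree p tp) (Tame⇒CutFree q tq)
Tame⇒CutFree (⇒R p)         tp        = Tame⇒CutFree p tp
Tame⇒CutFree (∀L _ _ p)     (_ , tp)  = Tame⇒CutFree p tp
Tame⇒CutFree (∀R _ _ _ _ p) tp        = Tame⇒CutFree p tp
Tame⇒CutFree (∃L _ _ _ _ p) tp        = Tame⇒CutFree p tp
Tame⇒CutFree (∃R _ _ p)     (_ , tp)  = Tame⇒CutFree p tp

private
  at-most-double : ∀ {S′ S} a b {s} → sizeS S′ ≤ a + s → sizeS S ≡ b + s → a ≤ 2 * b → sizeS S′ ≤ 2 * sizeS S
  at-most-double {S′} {S} a b {s} S′≤ S≡ a≤ = begin
    sizeS S′      ≤⟨ S′≤ ⟩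
    a + s         ≤⟨ +-mono-≤ a≤ (m≤m+n s (s + 0)) ⟩
    2 * b + 2 * s ≡⟨ *-distribˡ-+ 2 b s ⟨
    2 * (b + s)   ≡⟨ cong (2 *_) S≡ ⟨
    2 * sizeS S   ∎
    where open ≤-Reasoning

  left-premise : ∀ A′ A Γ Δ → sizeF A′ ≤ 2 * sizeF A → sizeS (A′ ∷ Γ ⊢ Δ) ≤ 2 * sizeS (A ∷ Γ ⊢ Δ)
  left-premise A′ A Γ Δ =
    at-most-double {A′ ∷ Γ ⊢ Δ} {A ∷ Γ ⊢ Δ} (sizeF A′) (sizeF A) (≤-reflexive (sizeS-∷ A′ Γ Δ)) (sizeS-∷ A Γ Δ)

  right-premise : ∀ Γ Δ A′ A → sizeF A′ ≤ 2 * sizeF A → sizeS (Γ ⊢ Δ ∷ʳ A′) ≤ 2 * sizeS (Γ ⊢ Δ ∷ʳ A)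
  right-premise Γ Δ A′ A =
    at-most-double {Γ ⊢ Δ ∷ʳ A′} {Γ ⊢ Δ ∷ʳ A} (sizeF A′) (sizeF A) (≤-reflexive (sizeS-∷ʳ Γ Δ A′)) (sizeS-∷ʳ Γ Δ A)

  ≤2* : ∀ {a b} → a ≤ b → a ≤ 2 * b
  ≤2* {a} {b} a≤b = ≤-trans a≤b (m≤m+n b (b + 0))

  ≤2*suc : ∀ {a b} → a ≤ b → a ≤ 2 * suc b
  ≤2*suc a≤b = ≤2* (m≤n⇒m≤1+n a≤b)

  ≤2*quantified : ∀ {a b} → a ≤ 2 * b → a ≤ 2 * (2 + b)
  ≤2*quantified {b = b} a≤ = ≤-trans a≤ (*-monoʳ-≤ 2 (m≤n+m b 2))

  ≤5^* : ∀ h c → c ≤ 5 ^ h * c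
  ≤5^* h c = ≤-trans (≤-reflexive (sym (*-identityˡ c))) (*-monoˡ-≤ c (m^n>0 5 h))

  unary-bound : ∀ {c p P} h → p ≤ 2 * c → P ≤ 5 ^ h * p → c + P ≤ 5 ^ suc h * c
  unary-bound {c} {p} {P} h p≤ P≤ = begin
    c + P                         ≤⟨ +-mono-≤ (≤5^* h c) (≤-trans P≤ (*-monoʳ-≤ (5 ^ h) p≤)) ⟩
    5 ^ h * c + 5 ^ h * (2 * c)
      ≤⟨ m≤m+n _ (2 * (5 ^ h * c)) ⟩
    5 ^ h * c + 5 ^ h * (2 * c) + 2 * (5 ^ h * c)
      ≡⟨ five (5 ^ h) c ⟩
    5 ^ suc h * c                 ∎
    where
    open ≤-Reasoning
    five : ∀ x c → x * c + x * (2 * c) + 2 * (x * c) ≡ 5 * x * c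
    five = solve-∀

  binary-bound : ∀ {c p q P Q} h₁ h₂ → p ≤ 2 * c → q ≤ 2 * c → P ≤ 5 ^ h₁ * p → Q ≤ 5 ^ h₂ * q →
                 c + P + Q ≤ 5 ^ suc (h₁ ⊔ h₂) * c
  binary-bound {c} {p} {q} {P} {Q} h₁ h₂ p≤ q≤ P≤ Q≤ = begin
    c + P + Q                   ≤⟨ +-mono-≤ (+-mono-≤ (≤5^* h c) (lift h₁ (m≤m⊔n h₁ h₂) p≤ P≤))
                                             (lift h₂ (m≤n⊔m h₁ h₂) q≤ Q≤) ⟩
    5 ^ h * c + 5 ^ h * (2 * c) + 5 ^ h * (2 * c)
      ≡⟨ five (5 ^ h) c ⟩
    5 ^ suc h * c               ∎
    where
    open ≤-Reasoning
    h = h₁ ⊔ h₂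
    lift : ∀ {r R} h′ → h′ ≤ h → r ≤ 2 * c → R ≤ 5 ^ h′ * r → R ≤ 5 ^ h * (2 * c)
    lift h′ h′≤ r≤ R≤ = ≤-trans R≤ (*-mono-≤ (^-monoʳ-≤ 5 h′≤) r≤)
    five : ∀ x c → x * c + x * (2 * c) + x * (2 * c) ≡ 5 * x * c
    five = solve-∀

  sizeS-∷∷ : ∀ A B Γ Δ → sizeS (A ∷ B ∷ Γ ⊢ Δ) ≡ sizeF A + sizeF B + sizeS (Γ ⊢ Δ)
  sizeS-∷∷ A B Γ Δ = trans (sizeS-∷ A (B ∷ Γ) Δ)
    (trans (cong (sizeF A +_) (sizeS-∷ B Γ Δ)) (sym (+-assoc (sizeF A) (sizeF B) _)))

  sizeS-∷ʳ∷ʳ : ∀ Γ Δ A B → sizeS (Γ ⊢ Δ ∷ʳ A ∷ʳ B) ≡ sizeF B + sizeF A + sizeS (Γ ⊢ Δ)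
  sizeS-∷ʳ∷ʳ Γ Δ A B = trans (sizeS-∷ʳ Γ (Δ ∷ʳ A) B)
    (trans (cong (sizeF B +_) (sizeS-∷ʳ Γ Δ A)) (sym (+-assoc (sizeF B) (sizeF A) _)))

  sizeS-∷-∷ʳ : ∀ A Γ Δ B → sizeS (A ∷ Γ ⊢ Δ ∷ʳ B) ≡ sizeF A + sizeF B + sizeS (Γ ⊢ Δ)
  sizeS-∷-∷ʳ A Γ Δ B = trans (sizeS-∷ A Γ (Δ ∷ʳ B))
    (trans (cong (sizeF A +_) (sizeS-∷ʳ Γ Δ B)) (sym (+-assoc (sizeF A) (sizeF B) _)))

  a+a≤2*a : ∀ a → a + a ≤ 2 * a
  a+a≤2*a a = ≤-reflexive (cong (a +_) (sym (+-identityʳ a)))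

sizeP-tame : ∀ {S} (p : Proof S) → Tame p → sizeP p ≤ 5 ^ height p * sizeS S
sizeP-tame {S} (ax _) _ = ≤-reflexive (sym (*-identityˡ (sizeS S)))
sizeP-tame (wL {Γ} {Δ} {A} _ p) tp = unary-bound (height p)
  (at-most-double {Γ ⊢ Δ} {A ∷ Γ ⊢ Δ} 0 (sizeF A) ≤-refl (sizeS-∷ A Γ Δ) z≤n) (sizeP-tame p tp)
sizeP-tame (wR {Γ} {Δ} {A} _ p) tp = unary-bound (height p)
  (at-most-double {Γ ⊢ Δ} {Γ ⊢ Δ ∷ʳ A} 0 (sizeF A) ≤-refl (sizeS-∷ʳ Γ Δ A) z≤n) (sizeP-tame p tp)
sizeP-tame (cL {Γ} {Δ} {A} p) tp = unary-bound (height p)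
  (at-most-double {A ∷ A ∷ Γ ⊢ Δ} {A ∷ Γ ⊢ Δ} (sizeF A + sizeF A) (sizeF A)
    (≤-reflexive (sizeS-∷∷ A A Γ Δ)) (sizeS-∷ A Γ Δ) (a+a≤2*a (sizeF A)))
  (sizeP-tame p tp)
sizeP-tame (cR {Γ} {Δ} {A} p) tp = unary-bound (height p)
  (at-most-double {Γ ⊢ Δ ∷ʳ A ∷ʳ A} {Γ ⊢ Δ ∷ʳ A} (sizeF A + sizeF A) (sizeF A)
    (≤-reflexive (sizeS-∷ʳ∷ʳ Γ Δ A A)) (sizeS-∷ʳ Γ Δ A) (a+a≤2*a (sizeF A)))
  (sizeP-tame p tp)
sizeP-tame (eL {Γ₁} {Γ₂} {Δ} {A} {B} p) tp = unary-bound (height p)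
  (≤2* (≤-reflexive (cong (λ x → suc (x + sizeFs Δ)) (sizeFs-swap Γ₁ A B Γ₂)))) (sizeP-tame p tp)
sizeP-tame (eR {Γ} {Δ₁} {Δ₂} {A} {B} p) tp = unary-bound (height p)
  (≤2* (≤-reflexive (cong (λ x → suc (sizeFs Γ + x)) (sizeFs-swap Δ₁ A B Δ₂)))) (sizeP-tame p tp)
sizeP-tame (¬L {Γ} {Δ} {A} p) tp = unary-bound (height p)
  (at-most-double {Γ ⊢ Δ ∷ʳ A} {¬ᶠ A ∷ Γ ⊢ Δ} (sizeF A) (sizeF (¬ᶠ A))
    (≤-reflexive (sizeS-∷ʳ Γ Δ A)) (sizeS-∷ (¬ᶠ A) Γ Δ) (≤2*suc ≤-refl))
  (sizeP-tame p tp)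
sizeP-tame (¬R {Γ} {Δ} {A} p) tp = unary-bound (height p)
  (at-most-double {A ∷ Γ ⊢ Δ} {Γ ⊢ Δ ∷ʳ ¬ᶠ A} (sizeF A) (sizeF (¬ᶠ A))
    (≤-reflexive (sizeS-∷ A Γ Δ)) (sizeS-∷ʳ Γ Δ (¬ᶠ A)) (≤2*suc ≤-refl))
  (sizeP-tame p tp)
sizeP-tame (∧L₁ {Γ} {Δ} {A} {B} _ p) tp = unary-bound (height p)
  (left-premise A (A ∧ᶠ B) Γ Δ (≤2*suc (m≤m+n _ _))) (sizeP-tame p tp)
sizeP-tame (∧L₂ {Γ} {Δ} {A} {B} _ p) tp = unary-bound (height p)
  (left-premise B (A ∧ᶠ B) Γ Δ (≤2*suc (m≤n+m _ _))) (sizeP-tame p tp)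
sizeP-tame (∧R {Γ} {Δ} {A} {B} p q) (tp , tq) = binary-bound (height p) (height q)
  (right-premise Γ Δ A (A ∧ᶠ B) (≤2*suc (m≤m+n _ _))) (right-premise Γ Δ B (A ∧ᶠ B) (≤2*suc (m≤n+m _ _)))
  (sizeP-tame p tp) (sizeP-tame q tq)
sizeP-tame (∨L {Γ} {Δ} {A} {B} p q) (tp , tq) = binary-bound (height p) (height q)
  (left-premise A (A ∨ᶠ B) Γ Δ (≤2*suc (m≤m+n _ _))) (left-premise B (A ∨ᶠ B) Γ Δ (≤2*suc (m≤n+m _ _)))
  (sizeP-tame p tp) (sizeP-tame q tq)
sizeP-tame (∨R₁ {Γ} {Δ} {A} {B} _ p) tp = unary-bound (height p)
  (right-premise Γ Δ A (A ∨ᶠ B) (≤2*suc (m≤m+n _ _))) (sizeP-tame p tp)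
sizeP-tame (∨R₂ {Γ} {Δ} {A} {B} _ p) tp = unary-bound (height p)
  (right-premise Γ Δ B (A ∨ᶠ B) (≤2*suc (m≤n+m _ _))) (sizeP-tame p tp)
sizeP-tame (⇒L {Γ} {Δ} {Π} {Λ} {A} {B} p q) (tp , tq) = binary-bound (height p) (height q)
  (at-most-double {Γ ⊢ Δ ∷ʳ A} {A ⇒ᶠ B ∷ Γ ++ Π ⊢ Δ ++ Λ} (sizeF A) (sizeF (A ⇒ᶠ B))
    (≤-trans (≤-reflexive (sizeS-∷ʳ Γ Δ A)) (+-monoʳ-≤ (sizeF A) (sizeS-++ˡ Γ Π Δ Λ)))
    (sizeS-∷ (A ⇒ᶠ B) (Γ ++ Π) (Δ ++ Λ)) (≤2*suc (m≤m+n _ _)))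
  (at-most-double {B ∷ Π ⊢ Λ} {A ⇒ᶠ B ∷ Γ ++ Π ⊢ Δ ++ Λ} (sizeF B) (sizeF (A ⇒ᶠ B))
    (≤-trans (≤-reflexive (sizeS-∷ B Π Λ)) (+-monoʳ-≤ (sizeF B) (sizeS-++ʳ Γ Π Δ Λ)))
    (sizeS-∷ (A ⇒ᶠ B) (Γ ++ Π) (Δ ++ Λ)) (≤2*suc (m≤n+m _ _)))
  (sizeP-tame p tp) (sizeP-tame q tq)
sizeP-tame (⇒R {Γ} {Δ} {A} {B} p) tp = unary-bound (height p)
  (at-most-double {A ∷ Γ ⊢ Δ ∷ʳ B} {Γ ⊢ Δ ∷ʳ A ⇒ᶠ B} (sizeF A + sizeF B) (sizeF (A ⇒ᶠ B))
    (≤-reflexive (sizeS-∷-∷ʳ A Γ Δ B)) (sizeS-∷ʳ Γ Δ (A ⇒ᶠ B))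
    (≤2*suc ≤-refl))
  (sizeP-tame p tp)
sizeP-tame (∀L {Γ} {Δ} {A} t _ p) (t≤2 , tp) = unary-bound (height p)
  (left-premise (inst A t) (∀ᶠ A) Γ Δ (≤2*quantified (sizeF-inst≤2* A t t≤2))) (sizeP-tame p tp)
sizeP-tame (∀R {Γ} {Δ} {A} a _ _ _ p) tp = unary-bound (height p)
  (right-premise Γ Δ (inst A (fvar a)) (∀ᶠ A) (≤2*quantified (sizeF-inst≤2* A (fvar a) (s≤s z≤n)))) (sizeP-tame p tp)
sizeP-tame (∃L {Γ} {Δ} {A} a _ _ _ p) tp = unary-bound (height p)
  (left-premise (inst A (fvar a)) (∃ᶠ A) Γ Δ (≤2*quantified (sizeF-inst≤2* A (fvar a) (s≤s z≤n)))) (sizeP-tame p tp)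
sizeP-tame (∃R {Γ} {Δ} {A} t _ p) (t≤2 , tp) = unary-bound (height p)
  (right-premise Γ Δ (inst A t) (∃ᶠ A) (≤2*quantified (sizeF-inst≤2* A t t≤2))) (sizeP-tame p tp)

-- The model of y + 2 ^ x = z cut off at N

bvarValue : List ℕ → ℕ → ℕ
bvarValue []        j       = 0
bvarValue (d ∷ env) zero    = d
bvarValue (d ∷ env) (suc j) = bvarValue env j

evalFn : ℕ → List ℕ → ℕ
evalFn 1 (n ∷ []) = suc n
evalFn _ _        = 0

mutual
  evalT : List ℕ → Term → ℕ
  evalT env (fvar _)  = 0
  evalT env (bvar j)  = bvarValue env j
  evalT env (fn g ts) = evalFn g (evalTs env ts)

  evalTs : List ℕ → List Term → List ℕ
  evalTs env []       = []
  evalTs env (t ∷ ts) = evalT env t ∷ evalTs env ts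

evalAtom : ℕ → List ℕ → Bool
evalAtom 0 (x ∷ y ∷ z ∷ []) = (y + 2 ^ x) ≡ᵇ z
evalAtom _ _                = false

evalF : ℕ → List ℕ → Formula → Bool
evalF N env (atom P ts) = evalAtom P (evalTs env ts)
evalF N env (¬ᶠ A)      = not (evalF N env A)
evalF N env (A ∧ᶠ B)    = evalF N env A ∧ evalF N env B
evalF N env (A ∨ᶠ B)    = evalF N env A ∨ evalF N env B
evalF N env (A ⇒ᶠ B)    = not (evalF N env A) ∨ evalF N env B
evalF N env (∀ᶠ A)      = all (λ d → evalF N (d ∷ env) A) (upTo (suc N))
evalF N env (∃ᶠ A)      = any (λ d → evalF N (d ∷ env) A) (upTo (suc N))

infix 4 _⊨_
_⊨_ : ℕ → Formula → Set
N ⊨ A = T (evalF N [] A)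

Valid : ℕ → Seq → Set
Valid N (Γ ⊢ Δ) = All (N ⊨_) Γ → Any (N ⊨_) Δ

module _ {N : ℕ} {p : ℕ → Bool} where

  all-upTo-elim : T (all p (upTo (suc N))) → ∀ {d} → d ≤ N → T (p d)
  all-upTo-elim holds d≤N = All.lookup (all⁺ p (upTo (suc N)) holds) (∈-upTo⁺ (s≤s d≤N))

  all-upTo-intro : (∀ d → T (p d)) → T (all p (upTo (suc N)))
  all-upTo-intro holds = all⁻ p (All.universal holds (upTo (suc N)))

  any-upTo-intro : ∀ {d} → d ≤ N → T (p d) → T (any p (upTo (suc N)))
  any-upTo-intro d≤N holds = any⁺ p (lose (∈-upTo⁺ (s≤s d≤N)) holds)

  any-upTo-elim : T (any p (upTo (suc N))) → Σ ℕ λ d → d ≤ N × T (p d)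
  any-upTo-elim holds with find (any⁻ p (upTo (suc N)) holds)
  ... | d , d∈ , pd = d , ≤-pred (∈-upTo⁻ d∈) , pd

all-cong : ∀ {p q : ℕ → Bool} → (∀ d → p d ≡ q d) → ∀ xs → all p xs ≡ all q xs
all-cong p≗q xs = cong and (map-cong p≗q xs)

any-cong : ∀ {p q : ℕ → Bool} → (∀ d → p d ≡ q d) → ∀ xs → any p xs ≡ any q xs
any-cong p≗q xs = cong or (map-cong p≗q xs)

bvarValue-last : ∀ env v → bvarValue (env ++ [ v ]) (length env) ≡ v
bvarValue-last []        v = refl
bvarValue-last (d ∷ env) v = bvarValue-last env v

bvarValue-++ : ∀ env j v → j ≢ length env → bvarValue (env ++ [ v ]) j ≡ bvarValue env j
bvarValue-++ []        zero    v j≢ = ⊥-elim (j≢ refl)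
bvarValue-++ []        (suc j) v j≢ = refl
bvarValue-++ (d ∷ env) zero    v j≢ = refl
bvarValue-++ (d ∷ env) (suc j) v j≢ = bvarValue-++ env j v (j≢ ∘ cong suc)

mutual
  evalT-closed : ∀ env u → WfT 0 u → evalT env u ≡ evalT [] u
  evalT-closed env (fvar a)  _  = refl
  evalT-closed env (fn g ts) wf = cong (evalFn g) (evalTs-closed env ts wf)

  evalTs-closed : ∀ env ts → WfTs 0 ts → evalTs env ts ≡ evalTs [] ts
  evalTs-closed env []       _          = refl
  evalTs-closed env (t ∷ ts) (wf , wfs) = cong₂ _∷_ (evalT-closed env t wf) (evalTs-closed env ts wfs)

mutual
  evalT-openT : ∀ env u t → WfT 0 u → evalT env (openT (length env) u t) ≡ evalT (env ++ [ evalT [] u ]) t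
  evalT-openT env u (fvar a) wf = refl
  evalT-openT env u (bvar j) wf with j ≡ᵇ length env in j≡ᵇ
  ... | true  rewrite ≡ᵇ⇒≡ j (length env) (subst T (sym j≡ᵇ) tt) =
    trans (evalT-closed env u wf) (sym (bvarValue-last env (evalT [] u)))
  ... | false = sym (bvarValue-++ env j (evalT [] u) λ j≡ → subst T j≡ᵇ (≡⇒≡ᵇ j (length env) j≡))
  evalT-openT env u (fn g ts) wf = cong (evalFn g) (evalTs-openTs env u ts wf)

  evalTs-openTs : ∀ env u ts → WfT 0 u → evalTs env (openTs (length env) u ts) ≡ evalTs (env ++ [ evalT [] u ]) ts
  evalTs-openTs env u []       wf = refl
  evalTs-openTs env u (t ∷ ts) wf = cong₂ _∷_ (evalT-openT env u t wf) (evalTs-openTs env u ts wf)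

evalF-openF : ∀ N env u A → WfT 0 u → evalF N env (openF (length env) u A) ≡ evalF N (env ++ [ evalT [] u ]) A
evalF-openF N env u (atom P ts) wf = cong (evalAtom P) (evalTs-openTs env u ts wf)
evalF-openF N env u (¬ᶠ A)      wf = cong not (evalF-openF N env u A wf)
evalF-openF N env u (A ∧ᶠ B)    wf = cong₂ _∧_ (evalF-openF N env u A wf) (evalF-openF N env u B wf)
evalF-openF N env u (A ∨ᶠ B)    wf = cong₂ _∨_ (evalF-openF N env u A wf) (evalF-openF N env u B wf)
evalF-openF N env u (A ⇒ᶠ B)    wf = cong₂ (λ a b → not a ∨ b) (evalF-openF N env u A wf) (evalF-openF N env u B wf)
evalF-openF N env u (∀ᶠ A)      wf = all-cong (λ d → evalF-openF N (d ∷ env) u A wf) (upTo (suc N))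
evalF-openF N env u (∃ᶠ A)      wf = any-cong (λ d → evalF-openF N (d ∷ env) u A wf) (upTo (suc N))

Irrelevant : ℕ → ℕ → Formula → Set
Irrelevant N k A = ∀ env → length env ≡ k → ∀ v → evalF N (env ++ [ v ]) A ≡ evalF N (env ++ [ 0 ]) A

mutual
  occursT-or-irrelevant : ∀ t k u → sizeT u ≤ sizeT (openT k u t)
    ⊎ (∀ env → length env ≡ k → ∀ v → evalT (env ++ [ v ]) t ≡ evalT (env ++ [ 0 ]) t)
  occursT-or-irrelevant (fvar a) k u = inj₂ λ _ _ _ → refl
  occursT-or-irrelevant (bvar j) k u with j ≡ᵇ k in j≡ᵇ
  ... | true  = inj₁ ≤-refl
  ... | false = inj₂ λ env len v →
    trans (bvarValue-++ env j v (j≢ env len)) (sym (bvarValue-++ env j 0 (j≢ env len)))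
    where
    j≢ : ∀ env → length env ≡ k → j ≢ length env
    j≢ env len j≡ = subst T j≡ᵇ (≡⇒≡ᵇ j k (trans j≡ len))
  occursT-or-irrelevant (fn g ts) k u with occursTs-or-irrelevant ts k u
  ... | inj₁ occ = inj₁ (m≤n⇒m≤1+n occ)
  ... | inj₂ irr = inj₂ λ env len v → cong (evalFn g) (irr env len v)

  occursTs-or-irrelevant : ∀ ts k u → sizeT u ≤ sizeTs (openTs k u ts)
    ⊎ (∀ env → length env ≡ k → ∀ v → evalTs (env ++ [ v ]) ts ≡ evalTs (env ++ [ 0 ]) ts)
  occursTs-or-irrelevant []       k u = inj₂ λ _ _ _ → refl
  occursTs-or-irrelevant (t ∷ ts) k u with occursT-or-irrelevant t k u | occursTs-or-irrelevant ts k u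
  ... | inj₁ occ  | _         = inj₁ (≤-trans occ (m≤m+n _ _))
  ... | inj₂ _    | inj₁ occ  = inj₁ (≤-trans occ (m≤n+m _ _))
  ... | inj₂ irr₁ | inj₂ irr₂ = inj₂ λ env len v → cong₂ _∷_ (irr₁ env len v) (irr₂ env len v)

private
  occurs-or-irrelevant₂ : ∀ {N k u A B} (_∙_ : Bool → Bool → Bool) (_∙ᶠ_ : Formula → Formula → Formula) →
    (∀ env → evalF N env (A ∙ᶠ B) ≡ evalF N env A ∙ evalF N env B) →
    sizeT u ≤ sizeF (openF k u A) ⊎ Irrelevant N k A →
    sizeT u ≤ sizeF (openF k u B) ⊎ Irrelevant N k B →
    sizeT u ≤ suc (sizeF (openF k u A) + sizeF (openF k u B)) ⊎ Irrelevant N k (A ∙ᶠ B)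
  occurs-or-irrelevant₂ _ _ _ (inj₁ occ) _ = inj₁ (m≤n⇒m≤1+n (≤-trans occ (m≤m+n _ _)))
  occurs-or-irrelevant₂ _ _ _ (inj₂ _) (inj₁ occ) = inj₁ (m≤n⇒m≤1+n (≤-trans occ (m≤n+m _ _)))
  occurs-or-irrelevant₂ _∙_ _ eval (inj₂ irrA) (inj₂ irrB) = inj₂ λ env len v →
    trans (eval (env ++ [ v ])) (trans (cong₂ _∙_ (irrA env len v) (irrB env len v)) (sym (eval (env ++ [ 0 ]))))

occurs-or-irrelevant : ∀ N A k u → sizeT u ≤ sizeF (openF k u A) ⊎ Irrelevant N k A
occurs-or-irrelevant N (atom P ts) k u with occursTs-or-irrelevant ts k u
... | inj₁ occ = inj₁ (m≤n⇒m≤1+n occ)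
... | inj₂ irr = inj₂ λ env len v → cong (evalAtom P) (irr env len v)
occurs-or-irrelevant N (¬ᶠ A) k u with occurs-or-irrelevant N A k u
... | inj₁ occ = inj₁ (m≤n⇒m≤1+n occ)
... | inj₂ irr = inj₂ λ env len v → cong not (irr env len v)
occurs-or-irrelevant N (A ∧ᶠ B) k u =
  occurs-or-irrelevant₂ {N} {k} {u} {A} {B} _∧_ _∧ᶠ_ (λ _ → refl) (occurs-or-irrelevant N A k u) (occurs-or-irrelevant N B k u)
occurs-or-irrelevant N (A ∨ᶠ B) k u =
  occurs-or-irrelevant₂ {N} {k} {u} {A} {B} _∨_ _∨ᶠ_ (λ _ → refl) (occurs-or-irrelevant N A k u) (occurs-or-irrelevant N B k u)
occurs-or-irrelevant N (A ⇒ᶠ B) k u =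
  occurs-or-irrelevant₂ {N} {k} {u} {A} {B} (λ a b → not a ∨ b) _⇒ᶠ_ (λ _ → refl)
    (occurs-or-irrelevant N A k u) (occurs-or-irrelevant N B k u)
occurs-or-irrelevant N (∀ᶠ A) k u with occurs-or-irrelevant N A (suc k) u
... | inj₁ occ = inj₁ (m≤n⇒m≤1+n (m≤n⇒m≤1+n occ))
... | inj₂ irr = inj₂ λ env len v → all-cong (λ d → irr (d ∷ env) (cong suc len) v) (upTo (suc N))
occurs-or-irrelevant N (∃ᶠ A) k u with occurs-or-irrelevant N A (suc k) u
... | inj₁ occ = inj₁ (m≤n⇒m≤1+n (m≤n⇒m≤1+n occ))
... | inj₂ irr = inj₂ λ env len v → any-cong (λ d → irr (d ∷ env) (cong suc len) v) (upTo (suc N))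

evalT≤sizeT : ∀ t → evalT [] t ≤ sizeT t
evalT≤sizeT (fvar a)                   = z≤n
evalT≤sizeT (bvar j)                   = z≤n
evalT≤sizeT (fn 1 (t ∷ []))            = s≤s (≤-trans (evalT≤sizeT t) (m≤m+n _ _))
evalT≤sizeT (fn 0 ts)                  = z≤n
evalT≤sizeT (fn 1 [])                  = z≤n
evalT≤sizeT (fn 1 (t ∷ t′ ∷ ts))       = z≤n
evalT≤sizeT (fn (suc (suc g)) ts)      = z≤n

-- If the instantiated variable occurs in A, the term t is part of the
-- instance and so evaluates to at most N; otherwise its value is irrelevant.
∀-instance : ∀ {N} A t → WfT 0 t → sizeF (inst A t) ≤ N → N ⊨ ∀ᶠ A → N ⊨ inst A t
∀-instance {N} A t wf inst≤N holds rewrite evalF-openF N [] t A wf with occurs-or-irrelevant N A 0 t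
... | inj₁ occ = all-upTo-elim {N} {λ d → evalF N [ d ] A} holds (≤-trans (evalT≤sizeT t) (≤-trans occ inst≤N))
... | inj₂ irr = subst T (sym (irr [] refl (evalT [] t))) (all-upTo-elim {N} {λ d → evalF N [ d ] A} holds z≤n)

∃-instance : ∀ {N} A t → WfT 0 t → sizeF (inst A t) ≤ N → N ⊨ inst A t → N ⊨ ∃ᶠ A
∃-instance {N} A t wf inst≤N holds rewrite evalF-openF N [] t A wf with occurs-or-irrelevant N A 0 t
... | inj₁ occ = any-upTo-intro {N} {λ d → evalF N [ d ] A} (≤-trans (evalT≤sizeT t) (≤-trans occ inst≤N)) holds
... | inj₂ irr = any-upTo-intro {N} {λ d → evalF N [ d ] A} z≤n (subst T (irr [] refl (evalT [] t)) holds)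

-- Soundness of small cut-free proofs without strong quantifiers

sizeS≤sizeP : ∀ {S} (p : Proof S) → sizeS S ≤ sizeP p
sizeS≤sizeP (ax _)         = ≤-refl
sizeS≤sizeP (wL _ p)       = m≤m+n _ _
sizeS≤sizeP (wR _ p)       = m≤m+n _ _
sizeS≤sizeP (cL p)         = m≤m+n _ _
sizeS≤sizeP (cR p)         = m≤m+n _ _
sizeS≤sizeP (eL p)         = m≤m+n _ _
sizeS≤sizeP (eR p)         = m≤m+n _ _
sizeS≤sizeP (cut p q)      = ≤-trans (m≤m+n _ _) (m≤m+n _ _)
sizeS≤sizeP (¬L p)         = m≤m+n _ _
sizeS≤sizeP (¬R p)         = m≤m+n _ _
sizeS≤sizeP (∧L₁ _ p)      = m≤m+n _ _
sizeS≤sizeP (∧L₂ _ p)      = m≤m+n _ _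
sizeS≤sizeP (∧R p q)       = ≤-trans (m≤m+n _ _) (m≤m+n _ _)
sizeS≤sizeP (∨L p q)       = ≤-trans (m≤m+n _ _) (m≤m+n _ _)
sizeS≤sizeP (∨R₁ _ p)      = m≤m+n _ _
sizeS≤sizeP (∨R₂ _ p)      = m≤m+n _ _
sizeS≤sizeP (⇒L p q)       = ≤-trans (m≤m+n _ _) (m≤m+n _ _)
sizeS≤sizeP (⇒R p)         = m≤m+n _ _
sizeS≤sizeP (∀L _ _ p)     = m≤m+n _ _
sizeS≤sizeP (∀R _ _ _ _ p) = m≤m+n _ _
sizeS≤sizeP (∃L _ _ _ _ p) = m≤m+n _ _
sizeS≤sizeP (∃R _ _ p)     = m≤m+n _ _

All⇒AllNoStrong : ∀ {p Γ} → All (NoStrong p) Γ → AllNoStrong p Γ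
All⇒AllNoStrong []          = tt
All⇒AllNoStrong (nsA ∷ ns) = nsA , All⇒AllNoStrong ns

Weak : Seq → Set
Weak (Γ ⊢ Δ) = All (NoStrong false) Γ × All (NoStrong true) Δ

exchange-↭ : ∀ Γ₁ (A B : Formula) Γ₂ → Γ₁ ++ A ∷ B ∷ Γ₂ ↭ Γ₁ ++ B ∷ A ∷ Γ₂
exchange-↭ Γ₁ A B Γ₂ = ↭-++⁺ˡ Γ₁ (↭-swap A B ↭-refl)

private
  unary≤ : ∀ S {P N} → sizeS S + P ≤ N → P ≤ N
  unary≤ S le = ≤-trans (m≤n+m _ (sizeS S)) le

  binary≤ˡ : ∀ S {P Q N} → sizeS S + P + Q ≤ N → P ≤ N
  binary≤ˡ S {P} {Q} le = ≤-trans (≤-trans (m≤n+m P (sizeS S)) (m≤m+n (sizeS S + P) Q)) le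

  binary≤ʳ : ∀ S {P Q N} → sizeS S + P + Q ≤ N → Q ≤ N
  binary≤ʳ S {P} le = ≤-trans (m≤n+m _ (sizeS S + P)) le

  T-not : ∀ {b} → ¬ T b → T (not b)
  T-not {false} _   = tt
  T-not {true}  ¬tt = ¬tt tt

  T-not⁻ : ∀ {b} → T (not b) → ¬ T b
  T-not⁻ {false} _ ()

  T-⇒⁺ : ∀ {a b} → (T a → T b) → T (not a ∨ b)
  T-⇒⁺ {false} _   = tt
  T-⇒⁺ {true}  a→b = a→b tt

  T-⇒⁻ : ∀ {a b} → T (not a ∨ b) → T a → T b
  T-⇒⁻ {true} b _ = b

module _ {N : ℕ} where

  private
    Any-∷ʳ⁻ : ∀ Δ {A} → Any (N ⊨_) (Δ ∷ʳ A) → Any (N ⊨_) Δ ⊎ N ⊨ A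
    Any-∷ʳ⁻ Δ holds with AnyP.++⁻ Δ holds
    ... | inj₁ inΔ        = inj₁ inΔ
    ... | inj₂ (here ⊨A) = inj₂ ⊨A

    Any-∷ʳ⁺ : ∀ Δ {A} → N ⊨ A → Any (N ⊨_) (Δ ∷ʳ A)
    Any-∷ʳ⁺ Δ ⊨A = AnyP.++⁺ʳ Δ (here ⊨A)

    last-implies : ∀ Δ {A B} → (N ⊨ A → N ⊨ B) → Any (N ⊨_) (Δ ∷ʳ A) → Any (N ⊨_) (Δ ∷ʳ B)
    last-implies Δ A→B holds with Any-∷ʳ⁻ Δ holds
    ... | inj₁ inΔ = AnyP.++⁺ˡ inΔ
    ... | inj₂ ⊨A  = Any-∷ʳ⁺ Δ (A→B ⊨A)

    left-principal≤ : ∀ {A Γ Δ} (p : Proof (A ∷ Γ ⊢ Δ)) → sizeP p ≤ N → sizeF A ≤ N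
    left-principal≤ {A} {Γ} {Δ} p p≤ =
      ≤-trans (m≤m+n (sizeF A) _) (≤-trans (≤-reflexive (sym (sizeS-∷ A Γ Δ))) (≤-trans (sizeS≤sizeP p) p≤))

    right-principal≤ : ∀ {Γ Δ A} (p : Proof (Γ ⊢ Δ ∷ʳ A)) → sizeP p ≤ N → sizeF A ≤ N
    right-principal≤ {Γ} {Δ} {A} p p≤ =
      ≤-trans (m≤m+n (sizeF A) _) (≤-trans (≤-reflexive (sym (sizeS-∷ʳ Γ Δ A))) (≤-trans (sizeS≤sizeP p) p≤))

  sound : ∀ {S} (p : Proof S) → CutFree p → sizeP p ≤ N → Weak S → Valid N S
  sound (ax _) _ _ _ (⊨A ∷ []) = here ⊨A
  sound {S} (wL _ p) cf p≤ (_ ∷ wΓ , wΔ) (_ ∷ ⊨Γ) = sound p cf (unary≤ S p≤) (wΓ , wΔ) ⊨Γ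
  sound {S} (wR _ p) cf p≤ (wΓ , wΔ) ⊨Γ = AnyP.++⁺ˡ (sound p cf (unary≤ S p≤) (wΓ , proj₁ (AllP.∷ʳ⁻ wΔ)) ⊨Γ)
  sound {S} (cL p) cf p≤ (wA ∷ wΓ , wΔ) (⊨A ∷ ⊨Γ) =
    sound p cf (unary≤ S p≤) (wA ∷ wA ∷ wΓ , wΔ) (⊨A ∷ ⊨A ∷ ⊨Γ)
  sound {S} (cR {Δ = Δ} p) cf p≤ (wΓ , wΔ) ⊨Γ =
    [ id , Any-∷ʳ⁺ Δ ]′
      (Any-∷ʳ⁻ (Δ ∷ʳ _) (sound p cf (unary≤ S p≤) (wΓ , AllP.∷ʳ⁺ wΔ (proj₂ (AllP.∷ʳ⁻ wΔ))) ⊨Γ))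
  sound {S} (eL {Γ₁} {Γ₂} {A = A} {B} p) cf p≤ (wΓ , wΔ) ⊨Γ =
    sound p cf (unary≤ S p≤) (All-resp-↭ (exchange-↭ Γ₁ B A Γ₂) wΓ , wΔ)
      (All-resp-↭ (exchange-↭ Γ₁ B A Γ₂) ⊨Γ)
  sound {S} (eR {Δ₁ = Δ₁} {Δ₂} {A} {B} p) cf p≤ (wΓ , wΔ) ⊨Γ =
    Any-resp-↭ (exchange-↭ Δ₁ A B Δ₂)
      (sound p cf (unary≤ S p≤) (wΓ , All-resp-↭ (exchange-↭ Δ₁ B A Δ₂) wΔ) ⊨Γ)
  sound (cut p q) () _ _ _
  sound {S} (¬L {Δ = Δ} p) cf p≤ (wA ∷ wΓ , wΔ) (⊨¬A ∷ ⊨Γ) =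
    [ id , ⊥-elim ∘ T-not⁻ ⊨¬A ]′ (Any-∷ʳ⁻ Δ (sound p cf (unary≤ S p≤) (wΓ , AllP.∷ʳ⁺ wΔ wA) ⊨Γ))
  sound {S} (¬R {Δ = Δ} {A} p) cf p≤ (wΓ , wΔ) ⊨Γ with AllP.∷ʳ⁻ wΔ | T? (evalF N [] A)
  ... | wΔ′ , wA | yes ⊨A = AnyP.++⁺ˡ (sound p cf (unary≤ S p≤) (wA ∷ wΓ , wΔ′) (⊨A ∷ ⊨Γ))
  ... | _        | no ⊭A  = Any-∷ʳ⁺ Δ (T-not ⊭A)
  sound {S} (∧L₁ _ p) cf p≤ ((wA , _) ∷ wΓ , wΔ) (⊨A∧B ∷ ⊨Γ) =
    sound p cf (unary≤ S p≤) (wA ∷ wΓ , wΔ) (proj₁ (Equivalence.to T-∧ ⊨A∧B) ∷ ⊨Γ)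
  sound {S} (∧L₂ _ p) cf p≤ ((_ , wB) ∷ wΓ , wΔ) (⊨A∧B ∷ ⊨Γ) =
    sound p cf (unary≤ S p≤) (wB ∷ wΓ , wΔ) (proj₂ (Equivalence.to T-∧ ⊨A∧B) ∷ ⊨Γ)
  sound {S} (∧R {Δ = Δ} p q) cf p≤ (wΓ , wΔ) ⊨Γ with AllP.∷ʳ⁻ wΔ
  ... | wΔ′ , (wA , wB) with Any-∷ʳ⁻ Δ (sound p (++-conicalˡ _ _ cf) (binary≤ˡ S p≤) (wΓ , AllP.∷ʳ⁺ wΔ′ wA) ⊨Γ)
  ...   | inj₁ inΔ = AnyP.++⁺ˡ inΔ
  ...   | inj₂ ⊨A  = last-implies Δ (λ ⊨B → Equivalence.from T-∧ (⊨A , ⊨B))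
                       (sound q (++-conicalʳ _ _ cf) (binary≤ʳ S p≤) (wΓ , AllP.∷ʳ⁺ wΔ′ wB) ⊨Γ)
  sound {S} (∨L p q) cf p≤ ((wA , wB) ∷ wΓ , wΔ) (⊨A∨B ∷ ⊨Γ) with Equivalence.to T-∨ ⊨A∨B
  ... | inj₁ ⊨A = sound p (++-conicalˡ _ _ cf) (binary≤ˡ S p≤) (wA ∷ wΓ , wΔ) (⊨A ∷ ⊨Γ)
  ... | inj₂ ⊨B = sound q (++-conicalʳ _ _ cf) (binary≤ʳ S p≤) (wB ∷ wΓ , wΔ) (⊨B ∷ ⊨Γ)
  sound {S} (∨R₁ {Δ = Δ} _ p) cf p≤ (wΓ , wΔ) ⊨Γ with AllP.∷ʳ⁻ wΔ
  ... | wΔ′ , (wA , _) =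
    last-implies Δ (Equivalence.from T-∨ ∘ inj₁) (sound p cf (unary≤ S p≤) (wΓ , AllP.∷ʳ⁺ wΔ′ wA) ⊨Γ)
  sound {S} (∨R₂ {Δ = Δ} _ p) cf p≤ (wΓ , wΔ) ⊨Γ with AllP.∷ʳ⁻ wΔ
  ... | wΔ′ , (_ , wB) =
    last-implies Δ (Equivalence.from T-∨ ∘ inj₂) (sound p cf (unary≤ S p≤) (wΓ , AllP.∷ʳ⁺ wΔ′ wB) ⊨Γ)
  sound {S} (⇒L {Γ} {Δ} p q) cf p≤ ((wA , wB) ∷ wΓΠ , wΔΛ) (⊨A⇒B ∷ ⊨ΓΠ)
    with AllP.++⁻ Γ wΓΠ | AllP.++⁻ Γ ⊨ΓΠ | AllP.++⁻ Δ wΔΛ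
  ... | wΓ , wΠ | ⊨Γ , ⊨Π | wΔ , wΛ
    with Any-∷ʳ⁻ Δ (sound p (++-conicalˡ _ _ cf) (binary≤ˡ S p≤) (wΓ , AllP.∷ʳ⁺ wΔ wA) ⊨Γ)
  ...   | inj₁ inΔ = AnyP.++⁺ˡ inΔ
  ...   | inj₂ ⊨A  =
    AnyP.++⁺ʳ Δ (sound q (++-conicalʳ _ _ cf) (binary≤ʳ S p≤) (wB ∷ wΠ , wΛ) (T-⇒⁻ ⊨A⇒B ⊨A ∷ ⊨Π))
  sound {S} (⇒R {Δ = Δ} {A} p) cf p≤ (wΓ , wΔ) ⊨Γ with AllP.∷ʳ⁻ wΔ | T? (evalF N [] A)
  ... | wΔ′ , (wA , wB) | yes ⊨A =
    last-implies Δ (λ ⊨B → T-⇒⁺ λ _ → ⊨B)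
      (sound p cf (unary≤ S p≤) (wA ∷ wΓ , AllP.∷ʳ⁺ wΔ′ wB) (⊨A ∷ ⊨Γ))
  ... | _ | no ⊭A = Any-∷ʳ⁺ Δ (T-⇒⁺ (⊥-elim ∘ ⊭A))
  sound {S} (∀L {A = A} t wf p) cf p≤ (wA ∷ wΓ , wΔ) (⊨∀A ∷ ⊨Γ) =
    sound p cf p≤′ (NoStrong-openF false A 0 t wA ∷ wΓ , wΔ) (∀-instance A t wf (left-principal≤ p p≤′) ⊨∀A ∷ ⊨Γ)
    where p≤′ = unary≤ S p≤
  sound (∀R _ _ _ _ _) _ _ (_ , wΔ) _ = ⊥-elim (proj₂ (AllP.∷ʳ⁻ wΔ))
  sound (∃L _ _ _ _ _) _ _ (() ∷ _ , _) _
  sound {S} (∃R {Δ = Δ} {A} t wf p) cf p≤ (wΓ , wΔ) ⊨Γ with AllP.∷ʳ⁻ wΔ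
  ... | wΔ′ , wA = last-implies Δ (∃-instance A t wf (right-principal≤ p p≤′))
                     (sound p cf p≤′ (wΓ , AllP.∷ʳ⁺ wΔ′ (NoStrong-openF true A 0 t wA)) ⊨Γ)
    where p≤′ = unary≤ S p≤

ClosureOfIdentity : Formula → Set
ClosureOfIdentity (∀ᶠ A)   = ClosureOfIdentity A
ClosureOfIdentity (A ⇒ᶠ B) = A ≡ B
ClosureOfIdentity _        = ⊥

ClosureOfIdentity-closeF : ∀ k a A → ClosureOfIdentity A → ClosureOfIdentity (closeF k a A)
ClosureOfIdentity-closeF k a (∀ᶠ A)   cl = ClosureOfIdentity-closeF (suc k) a A cl
ClosureOfIdentity-closeF k a (A ⇒ᶠ B) A≡B = cong (closeF k a) A≡B

ClosureOfIdentity-closeAll : ∀ xs A → ClosureOfIdentity (closeAll xs (A ⇒ᶠ A))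
ClosureOfIdentity-closeAll []       A = refl
ClosureOfIdentity-closeAll (x ∷ xs) A = ClosureOfIdentity-closeF 0 x (closeAll xs (A ⇒ᶠ A)) (ClosureOfIdentity-closeAll xs A)

ClosureOfIdentity-true : ∀ N env A → ClosureOfIdentity A → T (evalF N env A)
ClosureOfIdentity-true N env (∀ᶠ A)      cl   = all-upTo-intro {N} λ d → ClosureOfIdentity-true N (d ∷ env) A cl
ClosureOfIdentity-true N env (A ⇒ᶠ .A) refl = T-⇒⁺ {evalF N env A} id

-- Towers of exponentials

tower : ℕ → ℕ → ℕ
tower zero    x = x
tower (suc c) x = 2 ^ tower c x

tower-suc : ∀ c x → tower (suc c) x ≡ tower c (2 ^ x)
tower-suc zero    x = refl
tower-suc (suc c) x = cong (2 ^_) (tower-suc c x)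

tower-+ : ∀ a b x → tower a (tower b x) ≡ tower (a + b) x
tower-+ zero    b x = refl
tower-+ (suc a) b x = cong (2 ^_) (tower-+ a b x)

n<2^n : ∀ n → n < 2 ^ n
n<2^n zero    = s≤s z≤n
n<2^n (suc n) = +-mono-≤ (m^n>0 2 n) (≤-trans (n<2^n n) (m≤m+n (2 ^ n) 0))

n+n≤2^n : ∀ n → n + n ≤ 2 ^ n
n+n≤2^n zero          = z≤n
n+n≤2^n (suc zero)    = ≤-refl
n+n≤2^n (suc (suc n)) = begin
  suc (suc n) + suc (suc n) ≡⟨ cong suc (+-suc (suc n) (suc n)) ⟩
  2 + (suc n + suc n)       ≤⟨ +-mono-≤ (*-monoʳ-≤ 2 (m^n>0 2 n)) (n+n≤2^n (suc n)) ⟩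
  2 ^ suc n + 2 ^ suc n     ≡⟨ cong (2 ^ suc n +_) (sym (+-identityʳ (2 ^ suc n))) ⟩
  2 ^ suc (suc n)           ∎
  where open ≤-Reasoning

tower-inflationary : ∀ c x → c + x ≤ tower c x
tower-inflationary zero    x = ≤-refl
tower-inflationary (suc c) x = ≤-trans (s≤s (tower-inflationary c x)) (n<2^n (tower c x))

tower-monoʳ-≤ : ∀ c {x y} → x ≤ y → tower c x ≤ tower c y
tower-monoʳ-≤ zero    x≤y = x≤y
tower-monoʳ-≤ (suc c) x≤y = ^-monoʳ-≤ 2 (tower-monoʳ-≤ c x≤y)

tower-monoʳ-< : ∀ c {x y} → x < y → tower c x < tower c y
tower-monoʳ-< zero    x<y = x<y
tower-monoʳ-< (suc c) x<y = ^-monoʳ-< 2 (s≤s (s≤s z≤n)) (tower-monoʳ-< c x<y)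

tower-monoˡ-≤ : ∀ {c c′} x → c ≤ c′ → tower c x ≤ tower c′ x
tower-monoˡ-≤ {c} {c′} x c≤c′ with e , refl ← m≤n⇒∃[o]m+o≡n c≤c′ = begin
  tower c x           ≤⟨ m≤n+m (tower c x) e ⟩
  e + tower c x       ≤⟨ tower-inflationary e (tower c x) ⟩
  tower e (tower c x) ≡⟨ tower-+ e c x ⟩
  tower (e + c) x     ≡⟨ cong (λ n → tower n x) (+-comm e c) ⟩
  tower (c + e) x     ∎
  where open ≤-Reasoning

towerHeight : ETerm → ℕ
towerHeight x̂        = 0
towerHeight (num n)  = n
towerHeight (e ⊕ f)  = suc (towerHeight e ⊔ towerHeight f)
towerHeight (e ⊗ f)  = suc (suc (towerHeight e ⊔ towerHeight f))
towerHeight (two^ e) = suc (towerHeight e)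

mutual
  evalE≤tower : ∀ e i → evalE e i ≤ tower (towerHeight e) i
  evalE≤tower x̂        i = ≤-refl
  evalE≤tower (num n)  i = ≤-trans (m≤m+n n i) (tower-inflationary n i)
  evalE≤tower (e ⊕ f)  i =
    ≤-trans (+-mono-≤ (evalE≤tower-⊔ e i (m≤m⊔n (towerHeight e) (towerHeight f)))
                      (evalE≤tower-⊔ f i (m≤n⊔m (towerHeight e) (towerHeight f))))
            (n+n≤2^n (tower (towerHeight e ⊔ towerHeight f) i))
  evalE≤tower (e ⊗ f)  i = begin
    evalE e i * evalE f i ≤⟨ *-mono-≤ (≤-trans (evalE≤tower-⊔ e i (m≤m⊔n (towerHeight e) (towerHeight f))) t≤2^t)
                                      (≤-trans (evalE≤tower-⊔ f i (m≤n⊔m (towerHeight e) (towerHeight f))) t≤2^t) ⟩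
    2 ^ t * 2 ^ t         ≡⟨ ^-distribˡ-+-* 2 t t ⟨
    2 ^ (t + t)           ≤⟨ ^-monoʳ-≤ 2 (n+n≤2^n t) ⟩
    2 ^ 2 ^ t             ∎
    where
    open ≤-Reasoning
    t = tower (towerHeight e ⊔ towerHeight f) i
    t≤2^t : t ≤ 2 ^ t
    t≤2^t = <⇒≤ (n<2^n t)
  evalE≤tower (two^ e) i = ^-monoʳ-≤ 2 (evalE≤tower e i)

  evalE≤tower-⊔ : ∀ e i {h} → towerHeight e ≤ h → evalE e i ≤ tower h i
  evalE≤tower-⊔ e i e≤h = ≤-trans (evalE≤tower e i) (tower-monoˡ-≤ i e≤h)

2^⌊log₂⌋≤ : ∀ n → 2 ^ ⌊log₂ suc n ⌋ ≤ suc n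
2^⌊log₂⌋≤ n = go n (<-wellFounded (suc n))
  where
  go : ∀ n (acc : Acc _<_ (suc n)) → 2 ^ ⌊log2⌋ (suc n) acc ≤ suc n
  go zero    _        = ≤-refl
  go (suc n) (acc rs) = begin
    2 * 2 ^ ⌊log2⌋ (suc ⌊ n /2⌋) _ ≤⟨ *-monoʳ-≤ 2 (go ⌊ n /2⌋ _) ⟩
    2 * suc ⌊ n /2⌋               ≡⟨ *-suc 2 ⌊ n /2⌋ ⟩
    2 + 2 * ⌊ n /2⌋               ≤⟨ +-monoʳ-≤ 2 2*⌊n/2⌋≤n ⟩
    2 + n                         ∎
    where
    open ≤-Reasoning
    2*⌊n/2⌋≤n : 2 * ⌊ n /2⌋ ≤ n
    2*⌊n/2⌋≤n = ≤-trans (+-monoʳ-≤ ⌊ n /2⌋ (≤-trans (≤-reflexive (+-identityʳ _)) (⌊n/2⌋≤⌈n/2⌉ n)))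
                        (≤-reflexive (⌊n/2⌋+⌈n/2⌉≡n n))

exponent : ℕ → ℕ
exponent i = ⌊log₂ suc i ⌋

2^exponent≤ : ∀ i → 2 ^ exponent i ≤ suc i
2^exponent≤ = 2^⌊log₂⌋≤

exponent-pred-2^ : ∀ m → exponent (pred (2 ^ m)) ≡ m
exponent-pred-2^ m = trans (cong ⌊log₂_⌋ (suc-pred (2 ^ m) {{m^n≢0 2 m}})) (⌊log₂[2^n]⌋≡n m)

elementary<tower : ∀ e → Σ ℕ λ i → evalE e i < tower (suc (exponent i)) 0
elementary<tower e = i , (begin-strict
  evalE e i                  ≤⟨ evalE≤tower e i ⟩
  tower c i                  ≤⟨ tower-monoʳ-≤ c (n≤1+n i) ⟩
  tower c (suc i)            ≡⟨ cong (tower c) suc-i ⟩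
  tower c (tower 1 m)        ≡⟨ tower-+ c 1 m ⟩
  tower (c + 1) m            <⟨ tower-monoʳ-< (c + 1) m<tower ⟩
  tower (c + 1) (tower j 0)  ≡⟨ tower-+ (c + 1) j 0 ⟩
  tower m 0                  ≡⟨ cong (λ n → tower n 0) (exponent-pred-2^ m) ⟨
  tower (exponent i) 0       ≤⟨ tower-monoˡ-≤ 0 (n≤1+n (exponent i)) ⟩
  tower (suc (exponent i)) 0 ∎)
  where
  c = towerHeight e
  j = 4 + c
  m = c + 1 + j
  i = pred (2 ^ m)
  suc-i : suc i ≡ 2 ^ m
  suc-i = suc-pred (2 ^ m) {{m^n≢0 2 m}}
  m<tower : m < tower j 0
  m<tower = begin
    suc m                ≤⟨ m≤m+n (suc m) (6 * c + 2) ⟩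
    suc m + (6 * c + 2)  ≡⟨ arithmetic c ⟩
    8 * suc c            ≤⟨ *-monoʳ-≤ 8 (n<2^n c) ⟩
    8 * 2 ^ c            ≡⟨ ^-distribˡ-+-* 2 3 c ⟨
    2 ^ (3 + c)          ≤⟨ ^-monoʳ-≤ 2 (≤-trans (≤-reflexive (sym (+-identityʳ (3 + c)))) (tower-inflationary (3 + c) 0)) ⟩
    tower j 0            ∎
    where
    open ≤-Reasoning
    arithmetic : ∀ c → suc (c + 1 + (4 + c)) + (6 * c + 2) ≡ 8 * suc c
    arithmetic = solve-∀
  open ≤-Reasoning

-- Statman's formulas

𝟎 : Term
𝟎 = fn 0 []

𝐬 : Term → Term
𝐬 t = fn 1 [ t ]

-- E x y z  stands for  y + 2 ^ x = z.
E : Term → Term → Term → Formula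
E x y z = atom 0 (x ∷ y ∷ z ∷ [])

-- Level 0 x:        y + 2 ^ x exists for every y;
-- Level (k + 1) x:  y ↦ y + 2 ^ x maps Level k into Level k.
Level : ℕ → Term → Formula
Level zero    x = ∀ᶠ (∃ᶠ (E (shiftT (shiftT x)) (bvar 1) (bvar 0)))
Level (suc k) x = ∀ᶠ (Level k (bvar 0) ⇒ᶠ ∃ᶠ (E (shiftT (shiftT x)) (bvar 1) (bvar 0) ∧ᶠ Level k (bvar 0)))

-- The tower 2 ^ 2 ^ ⋯ ^ 2 ^ x with m + 1 twos exists.
HasTower : ℕ → Term → Formula
HasTower zero    x = ∃ᶠ (E (shiftT x) 𝟎 (bvar 0))
HasTower (suc m) x = ∃ᶠ (E (shiftT x) 𝟎 (bvar 0) ∧ᶠ HasTower m (bvar 0))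

Ax-zero : Formula
Ax-zero = ∀ᶠ (E 𝟎 (bvar 0) (𝐬 (bvar 0)))

Ax-suc : Formula
Ax-suc = ∀ᶠ (∀ᶠ (∀ᶠ (∀ᶠ
  (E (bvar 3) (bvar 2) (bvar 1) ⇒ᶠ (E (bvar 3) (bvar 1) (bvar 0) ⇒ᶠ E (𝐬 (bvar 3)) (bvar 2) (bvar 0))))))

Axioms : List Formula
Axioms = Ax-suc ∷ Ax-zero ∷ []

axiomCopies : ℕ → List Formula
axiomCopies zero    = []
axiomCopies (suc m) = Axioms ++ axiomCopies m

openF-Level : ∀ k j u t → shiftT u ≡ u → openF j u (Level k t) ≡ Level k (openT j u t)
openF-Level zero    j u t u↑ = cong (λ x → ∀ᶠ (∃ᶠ (E x (bvar 1) (bvar 0)))) (openT-shiftT² j u t u↑)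
openF-Level (suc k) j u t u↑
  rewrite openF-Level k (suc j) u (bvar 0) u↑ | openF-Level k (suc (suc j)) u (bvar 0) u↑ | openT-shiftT² j u t u↑ = refl

openF-HasTower : ∀ m j u t → shiftT u ≡ u → openF j u (HasTower m t) ≡ HasTower m (openT j u t)
openF-HasTower zero    j u t u↑ rewrite openT-shiftT j u t u↑ = refl
openF-HasTower (suc m) j u t u↑ rewrite openT-shiftT j u t u↑ | openF-HasTower m (suc j) u (bvar 0) u↑ = refl

fvF-Level : ∀ k t → fvF (Level k t) ≡ fvT t
fvF-Level zero    t rewrite fvT-shiftT (shiftT t) | fvT-shiftT t = ++-identityʳ (fvT t)
fvF-Level (suc k) t rewrite fvF-Level k (bvar 0) | fvT-shiftT (shiftT t) | fvT-shiftT t | ++-identityʳ (fvT t) =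
  ++-identityʳ (fvT t)

fvF-HasTower : ∀ m t → fvF (HasTower m t) ≡ fvT t
fvF-HasTower zero    t rewrite fvT-shiftT t = ++-identityʳ (fvT t)
fvF-HasTower (suc m) t rewrite fvF-HasTower m (bvar 0) | fvT-shiftT t | ++-identityʳ (fvT t) = ++-identityʳ (fvT t)

fvFs-axiomCopies : ∀ m → fvFs (axiomCopies m) ≡ []
fvFs-axiomCopies zero    = refl
fvFs-axiomCopies (suc m) = fvFs-axiomCopies m

WfF-Level : ∀ k j t → WfT j t → WfF j (Level k t)
WfF-Level zero    j t wf = WfT-shiftT (suc j) (shiftT t) (WfT-shiftT j t wf) , s≤s (s≤s z≤n) , s≤s z≤n , tt
WfF-Level (suc k) j t wf = WfF-Level k (suc j) (bvar 0) (s≤s z≤n)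
  , ((WfT-shiftT (suc j) (shiftT t) (WfT-shiftT j t wf) , s≤s (s≤s z≤n) , s≤s z≤n , tt)
    , WfF-Level k (suc (suc j)) (bvar 0) (s≤s z≤n))

WfF-HasTower : ∀ m j t → WfT j t → WfF j (HasTower m t)
WfF-HasTower zero    j t wf = WfT-shiftT j t wf , tt , s≤s z≤n , tt
WfF-HasTower (suc m) j t wf = (WfT-shiftT j t wf , tt , s≤s z≤n , tt) , WfF-HasTower m (suc j) (bvar 0) (s≤s z≤n)

inst-Level-step : ∀ k x u → shiftT u ≡ u →
  inst (Level k (bvar 0) ⇒ᶠ ∃ᶠ (E x (bvar 1) (bvar 0) ∧ᶠ Level k (bvar 0))) u
    ≡ (Level k u ⇒ᶠ ∃ᶠ (E (openT 1 u x) u (bvar 0) ∧ᶠ Level k (bvar 0)))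
inst-Level-step k x u u↑ rewrite openF-Level k 0 u (bvar 0) u↑ | openF-Level k 1 u (bvar 0) u↑ = refl

inst-E∧Level : ∀ k x y u → shiftT u ≡ u →
  inst (E x y (bvar 0) ∧ᶠ Level k (bvar 0)) u ≡ (E (openT 0 u x) (openT 0 u y) u ∧ᶠ Level k u)
inst-E∧Level k x y u u↑ rewrite openF-Level k 0 u (bvar 0) u↑ = refl

WfF-Axioms : All (WfF 0) Axioms
WfF-Axioms = ((s≤s (s≤s (s≤s (s≤s z≤n))) , s≤s (s≤s (s≤s z≤n)) , s≤s (s≤s z≤n) , tt)
             , ((s≤s (s≤s (s≤s (s≤s z≤n))) , s≤s (s≤s z≤n) , s≤s z≤n , tt)
               , ((s≤s (s≤s (s≤s (s≤s z≤n))) , tt) , s≤s (s≤s (s≤s z≤n)) , s≤s z≤n , tt)))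
           ∷ (tt , s≤s z≤n , (s≤s z≤n , tt) , tt)
           ∷ []

WfF-axiomCopies : ∀ m → All (WfF 0) (axiomCopies m)
WfF-axiomCopies zero    = []
WfF-axiomCopies (suc m) = AllP.++⁺ WfF-Axioms (WfF-axiomCopies m)

-- Short tame proofs

TameProof : Seq → ℕ → Set
TameProof S h = Σ (Proof S) λ p → Tame p × height p ≤ h

raise : ∀ {S h h′} → h ≤ h′ → TameProof S h → TameProof S h′
raise h≤h′ (p , tp , p≤h) = p , tp , ≤-trans p≤h h≤h′

private variable
  Γ Δ : List Formula
  A B D : Formula
  h : ℕ

tax : WfF 0 A → TameProof ([ A ] ⊢ [ A ]) 0
tax wf = ax wf , tt , z≤n

twL : WfF 0 A → TameProof (Γ ⊢ Δ) h → TameProof (A ∷ Γ ⊢ Δ) (suc h)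
twL wf (p , tp , p≤h) = wL wf p , tp , s≤s p≤h

tcL : TameProof (A ∷ A ∷ Γ ⊢ Δ) h → TameProof (A ∷ Γ ⊢ Δ) (suc h)
tcL (p , tp , p≤h) = cL p , tp , s≤s p≤h

teL : ∀ Γ₁ → TameProof (Γ₁ ++ A ∷ B ∷ Γ ⊢ Δ) h → TameProof (Γ₁ ++ B ∷ A ∷ Γ ⊢ Δ) (suc h)
teL Γ₁ (p , tp , p≤h) = eL {Γ₁ = Γ₁} p , tp , s≤s p≤h

t∧L₁ : WfF 0 B → TameProof (A ∷ Γ ⊢ Δ) h → TameProof (A ∧ᶠ B ∷ Γ ⊢ Δ) (suc h)
t∧L₁ wf (p , tp , p≤h) = ∧L₁ wf p , tp , s≤s p≤h

t∧L₂ : WfF 0 A → TameProof (B ∷ Γ ⊢ Δ) h → TameProof (A ∧ᶠ B ∷ Γ ⊢ Δ) (suc h)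
t∧L₂ wf (p , tp , p≤h) = ∧L₂ wf p , tp , s≤s p≤h

t∧R : TameProof (Γ ⊢ [ A ]) h → TameProof (Γ ⊢ [ B ]) h → TameProof (Γ ⊢ [ A ∧ᶠ B ]) (suc h)
t∧R (p , tp , p≤h) (q , tq , q≤h) = ∧R {Δ = []} p q , (tp , tq) , s≤s (⊔-lub p≤h q≤h)

t⇒L : ∀ Γ {Π} → TameProof (Γ ⊢ [ A ]) h → TameProof (B ∷ Π ⊢ [ D ]) h →
      TameProof (A ⇒ᶠ B ∷ Γ ++ Π ⊢ [ D ]) (suc h)
t⇒L Γ (p , tp , p≤h) (q , tq , q≤h) = ⇒L {Δ = []} p q , (tp , tq) , s≤s (⊔-lub p≤h q≤h)

t⇒R : TameProof (A ∷ Γ ⊢ [ B ]) h → TameProof (Γ ⊢ [ A ⇒ᶠ B ]) (suc h)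
t⇒R (p , tp , p≤h) = ⇒R {Δ = []} p , tp , s≤s p≤h

t∀L : ∀ t → WfT 0 t → {t≤2 : True (sizeT t ≤? 2)} → inst A t ≡ B →
      TameProof (B ∷ Γ ⊢ Δ) h → TameProof (∀ᶠ A ∷ Γ ⊢ Δ) (suc h)
t∀L t wf {t≤2} refl (p , tp , p≤h) = ∀L t wf p , (toWitness t≤2 , tp) , s≤s p≤h

t∃R : ∀ t → WfT 0 t → {t≤2 : True (sizeT t ≤? 2)} → inst A t ≡ B →
      TameProof (Γ ⊢ [ B ]) h → TameProof (Γ ⊢ [ ∃ᶠ A ]) (suc h)
t∃R t wf {t≤2} refl (p , tp , p≤h) = ∃R {Δ = []} t wf p , (toWitness t≤2 , tp) , s≤s p≤h

t∀R : ∀ a → a ∉ fvFs Γ → a ∉ fvF A → inst A (fvar a) ≡ B →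
      TameProof (Γ ⊢ [ B ]) h → TameProof (Γ ⊢ [ ∀ᶠ A ]) (suc h)
t∀R a a∉Γ a∉A refl (p , tp , p≤h) = ∀R {Δ = []} a a∉Γ (λ ()) a∉A p , tp , s≤s p≤h

t∃L : ∀ a → a ∉ fvFs Γ → a ∉ fvF D → a ∉ fvF A → inst A (fvar a) ≡ B →
      TameProof (B ∷ Γ ⊢ [ D ]) h → TameProof (∃ᶠ A ∷ Γ ⊢ [ D ]) (suc h)
t∃L a a∉Γ a∉D a∉A refl (p , tp , p≤h) = ∃L a a∉Γ (∉-++ _ a∉D λ ()) a∉A p , tp , s≤s p≤h

tweaken : ∀ R → All (WfF 0) R → TameProof ([ A ] ⊢ [ D ]) h → TameProof (A ∷ R ⊢ [ D ]) (length R * 2 + h)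
tweaken []      []         p = p
tweaken (C ∷ R) (wC ∷ wfs) p = teL [] (twL wC (tweaken R wfs p))

fresh : ∀ {a xs} {_ : False (a ∈? xs)} → a ∉ xs
fresh {_} {_} {a∉xs} = toWitnessFalse a∉xs

∉-Level : ∀ {a} k t → a ∉ fvT t → a ∉ fvF (Level k t)
∉-Level k t a∉ = subst (_ ∉_) (sym (fvF-Level k t)) a∉

∉-∧ : ∀ {a} A B → a ∉ fvF A → a ∉ fvF B → a ∉ fvF (A ∧ᶠ B)
∉-∧ A B = ∉-++ (fvF A)

∉-⇒ : ∀ {a} A B → a ∉ fvF A → a ∉ fvF B → a ∉ fvF (A ⇒ᶠ B)
∉-⇒ A B = ∉-++ (fvF A)

∉-Level-bvar : ∀ {a} k → a ∉ fvF (Level k (bvar 0))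
∉-Level-bvar k = ∉-Level k (bvar 0) λ ()

private
  wfE : ∀ a b c → WfF 0 (E (fvar a) (fvar b) (fvar c))
  wfE a b c = tt , tt , tt , tt

  wfLevel : ∀ k a → WfF 0 (Level k (fvar a))
  wfLevel k a = WfF-Level k 0 (fvar a) tt

E-zero : TameProof (Axioms ⊢ [ E 𝟎 (fvar 0) (𝐬 (fvar 0)) ]) 2
E-zero = twL (All.head WfF-Axioms) (t∀L (fvar 0) tt refl (tax (tt , tt , (tt , tt) , tt)))

-- The free variables 0, 1, 2, 3 play the roles of a, y, z, w in
-- y + 2 ^ a = z, z + 2 ^ a = w ⊢ y + 2 ^ (a + 1) = w.
E-suc : TameProof (E (fvar 0) (fvar 2) (fvar 3) ∷ E (fvar 0) (fvar 1) (fvar 2) ∷ Axioms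
                   ⊢ [ E (𝐬 (fvar 0)) (fvar 1) (fvar 3) ]) 11
E-suc =
  teL [] (teL [ E (fvar 0) (fvar 1) (fvar 2) ] (teL []
    (t∀L (fvar 0) tt refl (t∀L (fvar 1) tt refl
    (t∀L (fvar 2) tt refl (t∀L (fvar 3) tt refl
    (t⇒L [ E (fvar 0) (fvar 1) (fvar 2) ] (raise z≤n (tax (wfE 0 1 2)))
    (t⇒L [ E (fvar 0) (fvar 2) (fvar 3) ] (raise z≤n (tax (wfE 0 2 3)))
    (tweaken [ Ax-zero ] (All.lookup WfF-Axioms (there (here refl)) ∷ []) (tax ((tt , tt) , tt , tt , tt)))))))))))

-- For y in Level (k - 1), applying the hypothesis twice gives z = y + 2 ^ a
-- and w = z + 2 ^ a in Level (k - 1), and E-suc shows w = y + 2 ^ (a + 1).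
level-suc : ∀ k → TameProof (Level k (fvar 0) ∷ Axioms ⊢ [ Level k (𝐬 (fvar 0)) ]) 35
level-suc zero = raise (≤ᵇ⇒≤ 19 35 tt) (t∀R 1 fresh fresh refl (tcL (t∀L (fvar 1) tt refl from-z)))
  where
  from-w : TameProof (∃ᶠ (E (fvar 0) (fvar 2) (bvar 0)) ∷ E (fvar 0) (fvar 1) (fvar 2) ∷ Axioms
                      ⊢ [ ∃ᶠ (E (𝐬 (fvar 0)) (fvar 1) (bvar 0)) ]) 13
  from-w = t∃L 3 fresh fresh fresh refl (t∃R (fvar 3) tt refl E-suc)
  from-z : TameProof (∃ᶠ (E (fvar 0) (fvar 1) (bvar 0)) ∷ Level 0 (fvar 0) ∷ Axioms
                      ⊢ [ ∃ᶠ (E (𝐬 (fvar 0)) (fvar 1) (bvar 0)) ]) 16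
  from-z = t∃L 2 fresh fresh fresh refl (teL [] (t∀L (fvar 2) tt refl from-w))
level-suc (suc k) =
  t∀R 1 context-fresh (∉-⇒ (Level k (bvar 0)) (∃ᶠ (E (𝐬 (fvar 0)) (bvar 1) (bvar 0) ∧ᶠ Level k (bvar 0)))
                            (∉-Level-bvar k) (body-fresh (𝐬 (fvar 0)) (bvar 1) fresh))
    (inst-Level-step k (𝐬 (fvar 0)) (fvar 1) refl)
  (t⇒R (teL [] (tcL (teL [ Level (suc k) (fvar 0) ]
  (t∀L (fvar 1) tt (inst-Level-step k (fvar 0) (fvar 1) refl)
  (t⇒L [ Level k (fvar 1) ] (raise z≤n (tax (wfLevel k 1)))
  (t∃L 2 context-fresh goal-fresh (body-fresh (fvar 0) (fvar 1) fresh)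
    (inst-E∧Level k (fvar 0) (fvar 1) (fvar 2) refl) from-z)))))))
  where
  goal : Formula
  goal = ∃ᶠ (E (𝐬 (fvar 0)) (fvar 1) (bvar 0) ∧ᶠ Level k (bvar 0))
  body-fresh : ∀ {a} x y → a ∉ fvF (E x y (bvar 0)) → a ∉ fvF (E x y (bvar 0) ∧ᶠ Level k (bvar 0))
  body-fresh x y a∉ = ∉-∧ (E x y (bvar 0)) (Level k (bvar 0)) a∉ (∉-Level-bvar k)
  goal-fresh : ∀ {a} {_ : False (a ∈? (0 ∷ 1 ∷ []))} → a ∉ fvF goal
  goal-fresh {_} {a∉} = body-fresh (𝐬 (fvar 0)) (fvar 1) (toWitnessFalse a∉)
  context-fresh : ∀ {a} {_ : False (a ∈? [ 0 ])} → a ∉ fvFs (Level (suc k) (fvar 0) ∷ Axioms)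
  context-fresh {_} {a∉} = ∉-++ _ (∉-Level (suc k) (fvar 0) (toWitnessFalse a∉)) λ ()
  copy-w : TameProof (Level k (fvar 3) ∷ E (fvar 0) (fvar 2) (fvar 3) ∷ E (fvar 0) (fvar 1) (fvar 2) ∷ Axioms
                      ⊢ [ Level k (fvar 3) ]) 12
  copy-w = raise (≤ᵇ⇒≤ 8 12 tt)
    (tweaken (E (fvar 0) (fvar 2) (fvar 3) ∷ E (fvar 0) (fvar 1) (fvar 2) ∷ Axioms)
             (wfE 0 2 3 ∷ wfE 0 1 2 ∷ WfF-Axioms) (tax (wfLevel k 3)))
  from-w : TameProof (E (fvar 0) (fvar 2) (fvar 3) ∧ᶠ Level k (fvar 3) ∷ E (fvar 0) (fvar 1) (fvar 2) ∷ Axioms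
                      ⊢ [ goal ]) 18
  from-w = tcL (t∧L₁ (wfLevel k 3) (teL [] (t∧L₂ (wfE 0 2 3)
    (t∃R (fvar 3) tt (inst-E∧Level k (𝐬 (fvar 0)) (fvar 1) (fvar 3) refl)
    (t∧R (twL (wfLevel k 3) E-suc) copy-w)))))
  from-z : TameProof (E (fvar 0) (fvar 1) (fvar 2) ∧ᶠ Level k (fvar 2) ∷ Level (suc k) (fvar 0) ∷ Axioms
                      ⊢ [ goal ]) 27
  from-z = tcL (t∧L₁ (wfLevel k 2) (teL [] (t∧L₂ (wfE 0 1 2)
    (teL [ Level k (fvar 2) ] (teL []
    (t∀L (fvar 2) tt (inst-Level-step k (fvar 0) (fvar 2) refl)
    (t⇒L [ Level k (fvar 2) ] (raise z≤n (tax (wfLevel k 2)))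
    (t∃L 3 fresh goal-fresh (body-fresh (fvar 0) (fvar 2) fresh)
      (inst-E∧Level k (fvar 0) (fvar 2) (fvar 3) refl) from-w))))))))

level-zero : ∀ k → TameProof (Axioms ⊢ [ Level k 𝟎 ]) 39
level-zero zero = raise (≤ᵇ⇒≤ 4 39 tt) (t∀R 0 fresh fresh refl (t∃R (𝐬 (fvar 0)) (tt , tt) refl E-zero))
level-zero (suc k) =
  t∀R 0 fresh (∉-⇒ (Level k (bvar 0)) (∃ᶠ (E 𝟎 (bvar 1) (bvar 0) ∧ᶠ Level k (bvar 0)))
                   (∉-Level-bvar k) (∉-∧ (E 𝟎 (bvar 1) (bvar 0)) (Level k (bvar 0)) fresh (∉-Level-bvar k)))
    (inst-Level-step k 𝟎 (fvar 0) refl)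
  (t⇒R (t∃R (𝐬 (fvar 0)) (tt , tt) (inst-E∧Level k 𝟎 (fvar 0) (𝐬 (fvar 0)) refl)
  (t∧R (raise (≤ᵇ⇒≤ 3 35 tt) (twL (wfLevel k 0) E-zero)) (level-suc k))))

-- tower-from-level spends 11 inferences per level, and level-zero (height 39)
-- has to fit below 9 of them.
towerProofHeight : ℕ → ℕ
towerProofHeight zero    = 30
towerProofHeight (suc m) = 11 + towerProofHeight m

30≤towerProofHeight : ∀ m → 30 ≤ towerProofHeight m
30≤towerProofHeight zero    = ≤-refl
30≤towerProofHeight (suc m) = ≤-trans (30≤towerProofHeight m) (m≤n+m _ 11)

axiomCopies-weakening≤ : ∀ m → length (axiomCopies m) * 2 + 0 ≤ towerProofHeight m
axiomCopies-weakening≤ zero    = z≤n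
axiomCopies-weakening≤ (suc m) = +-monoʳ-≤ 4 (≤-trans (axiomCopies-weakening≤ m) (m≤n+m _ 7))

-- Instantiating Level m x at 0, which lies in Level (m - 1), gives z = 2 ^ x
-- in Level (m - 1), and then HasTower (m - 1) z.
tower-from-level : ∀ m x → WfT 0 x → m ∉ fvT x →
                   TameProof (Level m x ∷ axiomCopies m ⊢ [ HasTower m x ]) (towerProofHeight m)
tower-from-level zero x wf _ = raise (≤ᵇ⇒≤ 1 30 tt) (t∀L 𝟎 tt inst≡ (tax (WfF-HasTower 0 0 x wf)))
  where
  inst≡ : inst (∃ᶠ (E (shiftT (shiftT x)) (bvar 1) (bvar 0))) 𝟎 ≡ HasTower 0 x
  inst≡ rewrite shiftT-closed x wf | shiftT-closed x wf | openT-closed 1 𝟎 x wf = refl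
tower-from-level (suc m) x wf a∉x =
  t∀L 𝟎 tt inst-at-0
  (t⇒L Axioms (raise 39≤ (level-zero m))
  (t∃L a a∉copies (subst (a ∉_) (sym (fvF-HasTower (suc m) x)) a∉x) a∉body inst-at-a
  (tcL (t∧L₁ (wfLevel m a) (teL [] (t∧L₂ wfE-x
  (t∃R (fvar a) tt inst-tower
  (t∧R (raise weakening≤ (twL (wfLevel m a) (tweaken (axiomCopies m) (WfF-axiomCopies m) (tax wfE-x))))
       (teL [] (twL wfE-x (tower-from-level m (fvar a) tt λ { (here m≡a) → 1+n≢n (sym m≡a) })))))))))))
  where
  a = suc m
  wfE-x : WfF 0 (E x 𝟎 (fvar a))
  wfE-x = wf , tt , tt , tt
  39≤ : 39 ≤ 9 + towerProofHeight m
  39≤ = +-monoʳ-≤ 9 (30≤towerProofHeight m)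
  weakening≤ : suc (length (axiomCopies m) * 2 + 0) ≤ 2 + towerProofHeight m
  weakening≤ = s≤s (m≤n⇒m≤1+n (axiomCopies-weakening≤ m))
  a∉copies : a ∉ fvFs (axiomCopies m)
  a∉copies = subst (a ∉_) (sym (fvFs-axiomCopies m)) λ ()
  a∉body : a ∉ fvF (E x 𝟎 (bvar 0) ∧ᶠ Level m (bvar 0))
  a∉body = ∉-∧ (E x 𝟎 (bvar 0)) (Level m (bvar 0)) (∉-++ (fvT x) a∉x λ ()) (∉-Level-bvar m)
  inst-at-0 : inst (Level m (bvar 0) ⇒ᶠ ∃ᶠ (E (shiftT (shiftT x)) (bvar 1) (bvar 0) ∧ᶠ Level m (bvar 0))) 𝟎
              ≡ (Level m 𝟎 ⇒ᶠ ∃ᶠ (E x 𝟎 (bvar 0) ∧ᶠ Level m (bvar 0)))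
  inst-at-0 rewrite inst-Level-step m (shiftT (shiftT x)) 𝟎 refl
                  | shiftT-closed x wf | shiftT-closed x wf | openT-closed 1 𝟎 x wf = refl
  inst-at-a : inst (E x 𝟎 (bvar 0) ∧ᶠ Level m (bvar 0)) (fvar a) ≡ (E x 𝟎 (fvar a) ∧ᶠ Level m (fvar a))
  inst-at-a rewrite inst-E∧Level m x 𝟎 (fvar a) refl | openT-closed 0 (fvar a) x wf = refl
  inst-tower : inst (E (shiftT x) 𝟎 (bvar 0) ∧ᶠ HasTower m (bvar 0)) (fvar a) ≡ (E x 𝟎 (fvar a) ∧ᶠ HasTower m (fvar a))
  inst-tower rewrite openF-HasTower m 0 (fvar a) (bvar 0) refl | shiftT-closed x wf | openT-closed 0 (fvar a) x wf = refl

⊨Ax-zero : ∀ N → N ⊨ Ax-zero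
⊨Ax-zero N = all-upTo-intro {N} λ y → ≡⇒≡ᵇ (y + 1) (suc y) (+-comm y 1)

⊨Ax-suc : ∀ N → N ⊨ Ax-suc
⊨Ax-suc N =
  all-upTo-intro {N} λ x → all-upTo-intro {N} λ y → all-upTo-intro {N} λ z → all-upTo-intro {N} λ w →
  T-⇒⁺ λ y+2^x≡z → T-⇒⁺ λ z+2^x≡w → ≡⇒≡ᵇ (y + 2 ^ suc x) w (begin
    y + 2 ^ suc x       ≡⟨ cong (y +_) (cong (2 ^ x +_) (+-identityʳ (2 ^ x))) ⟩
    y + (2 ^ x + 2 ^ x) ≡⟨ +-assoc y (2 ^ x) (2 ^ x) ⟨
    y + 2 ^ x + 2 ^ x   ≡⟨ cong (_+ 2 ^ x) (≡ᵇ⇒≡ (y + 2 ^ x) z y+2^x≡z) ⟩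
    z + 2 ^ x           ≡⟨ ≡ᵇ⇒≡ (z + 2 ^ x) w z+2^x≡w ⟩
    w                   ∎)
  where open ≡-Reasoning

⊨axiomCopies : ∀ N m → All (N ⊨_) (axiomCopies m)
⊨axiomCopies N zero    = []
⊨axiomCopies N (suc m) = ⊨Ax-suc N ∷ ⊨Ax-zero N ∷ ⊨axiomCopies N m

mutual
  evalT-shiftT : ∀ d env t → evalT (d ∷ env) (shiftT t) ≡ evalT env t
  evalT-shiftT d env (fvar a)  = refl
  evalT-shiftT d env (bvar j)  = refl
  evalT-shiftT d env (fn g ts) = cong (evalFn g) (evalTs-shiftTs d env ts)

  evalTs-shiftTs : ∀ d env ts → evalTs (d ∷ env) (shiftTs ts) ≡ evalTs env ts
  evalTs-shiftTs d env []       = refl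
  evalTs-shiftTs d env (t ∷ ts) = cong₂ _∷_ (evalT-shiftT d env t) (evalTs-shiftTs d env ts)

2^evalT≡ : ∀ d env t → T ((0 + 2 ^ evalT (d ∷ env) (shiftT t)) ≡ᵇ d) → 2 ^ evalT env t ≡ d
2^evalT≡ d env t 2^t≡d = trans (cong (2 ^_) (sym (evalT-shiftT d env t))) (≡ᵇ⇒≡ _ d 2^t≡d)

HasTower⇒tower≤ : ∀ N m env t → T (evalF N env (HasTower m t)) → tower (suc m) (evalT env t) ≤ N
HasTower⇒tower≤ N zero env t holds with any-upTo-elim {N} holds
... | d , d≤N , 2^t≡d = subst (_≤ N) (sym (2^evalT≡ d env t 2^t≡d)) d≤N
HasTower⇒tower≤ N (suc m) env t holds with any-upTo-elim {N} holds
... | d , d≤N , 2^t≡d∧tower with Equivalence.to T-∧ 2^t≡d∧tower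
...   | 2^t≡d , tower-d = begin
  tower (suc (suc m)) (evalT env t) ≡⟨ tower-suc (suc m) (evalT env t) ⟩
  tower (suc m) (2 ^ evalT env t)   ≡⟨ cong (tower (suc m)) (2^evalT≡ d env t 2^t≡d) ⟩
  tower (suc m) d                   ≤⟨ HasTower⇒tower≤ N m (d ∷ env) (bvar 0) tower-d ⟩
  N                                 ∎
  where open ≤-Reasoning

matrixLevel : ℕ → Formula
matrixLevel d = matrix (Level d 𝟎)

matrixVariables : ℕ → List ℕ
matrixVariables d = deduplicate _≟_ (fvF (matrixLevel d))

closureAxiom : ℕ → Formula
closureAxiom d = closeAll (matrixVariables d) (matrixLevel d ⇒ᶠ matrixLevel d)

Sequent : ℕ → Seq
Sequent i = closureAxiom (exponent i) ∷ axiomCopies (suc (exponent i)) ⊢ [ HasTower (exponent i) 𝟎 ]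

MatrixOf-Level : ∀ d → MatrixOf [] (Level d 𝟎) (matrixLevel d)
MatrixOf-Level d = matrix-MatrixOf (Level d 𝟎)

WfF-closureAxiom : ∀ d → WfF 0 (closureAxiom d)
WfF-closureAxiom d = WfF-closeAll (matrixVariables d) (matrixLevel d ⇒ᶠ matrixLevel d) (wf , wf)
  where wf = proj₂ (proj₂ (MatrixOf-Level d)) (WfF-Level d 0 𝟎 tt)

tower-proof : ∀ d → TameProof (Level d 𝟎 ∷ axiomCopies d ⊢ [ HasTower d 𝟎 ]) (towerProofHeight d)
tower-proof d = tower-from-level d 𝟎 tt λ ()

proof : ∀ i → Proof (Sequent i)
proof i = wL (WfF-closureAxiom d) (cut {Δ = []} (proj₁ (level-zero d)) (proj₁ (tower-proof d)))
  where d = exponent i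

cuts-proof : ∀ i → cuts (proof i) ≡ [ Level (exponent i) 𝟎 ]
cuts-proof i = cong (Level d 𝟎 ∷_) (cong₂ _++_ (Tame⇒CutFree (proj₁ level) (proj₁ (proj₂ level)))
                                               (Tame⇒CutFree (proj₁ towers) (proj₁ (proj₂ towers))))
  where
  d = exponent i
  level = level-zero d
  towers = tower-proof d

cut-closure-in-antecedent : ∀ i A → A ∈ cuts (proof i) →
  Σ (List ℕ) λ xs → Unique xs
    × (∀ a → (a ∈ xs) ⇔ (a ∈ fvF (matrix A)))
    × (closeAll xs (matrix A ⇒ᶠ matrix A) ∈ antecedent (Sequent i))
cut-closure-in-antecedent i A A∈ with subst (A ∈_) (cuts-proof i) A∈
... | here refl = matrixVariables d , deduplicate-! _
                , (λ a → mk⇔ (AnyP.deduplicate⁻ _≟_) (AnyP.deduplicate⁺ _≟_ λ x≡ y≡ → trans y≡ (sym x≡)))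
                , here refl
  where d = exponent i

NoStrong-closureAxiom : ∀ d → NoStrong false (closureAxiom d)
NoStrong-closureAxiom d = NoStrong-closeAll (matrixVariables d) (matrixLevel d ⇒ᶠ matrixLevel d)
  (QuantifierFree⇒NoStrong true (matrixLevel d) qf , QuantifierFree⇒NoStrong false (matrixLevel d) qf)
  where qf = proj₁ (MatrixOf-Level d)

NoStrong-axiomCopies : ∀ m → All (NoStrong false) (axiomCopies m)
NoStrong-axiomCopies zero    = []
NoStrong-axiomCopies (suc m) = (tt , tt , tt) ∷ tt ∷ NoStrong-axiomCopies m

NoStrong-HasTower : ∀ m t → NoStrong true (HasTower m t)
NoStrong-HasTower zero    t = tt
NoStrong-HasTower (suc m) t = tt , NoStrong-HasTower m (bvar 0)

weak : ∀ i → Weak (Sequent i)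
weak i = NoStrong-closureAxiom d ∷ NoStrong-axiomCopies (suc d) , NoStrong-HasTower d 𝟎 ∷ []
  where d = exponent i

⊨antecedent : ∀ N i → All (N ⊨_) (antecedent (Sequent i))
⊨antecedent N i = ⊨closure ∷ ⊨axiomCopies N (suc d)
  where
  d = exponent i
  ⊨closure : N ⊨ closureAxiom d
  ⊨closure = ClosureOfIdentity-true N [] (closureAxiom d) (ClosureOfIdentity-closeAll (matrixVariables d) (matrixLevel d))

tower≤sizeP : ∀ i (p : Proof (Sequent i)) → CutFree p → tower (suc (exponent i)) 0 ≤ sizeP p
tower≤sizeP i p cf with sound p cf ≤-refl (weak i) (⊨antecedent (sizeP p) i)
... | here ⊨tower = HasTower⇒tower≤ (sizeP p) (exponent i) [] 𝟎 ⊨tower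

no-elementary-bound : ∀ e → ¬ (∀ i → Σ (Proof (Sequent i)) λ p → CutFree p × sizeP p ≤ evalE e i)
no-elementary-bound e bounded with elementary<tower e
... | i , e<tower with bounded i
...   | p , cf , p≤e = <⇒≱ e<tower (≤-trans (tower≤sizeP i p cf) p≤e)

-- Size bounds

sizeF-Level : ∀ k t → sizeF (Level k t) + 11 ≡ 18 * 2 ^ k + sizeT t
sizeF-Level zero t rewrite sizeT-shiftT (shiftT t) | sizeT-shiftT t = arithmetic (sizeT t)
  where
  arithmetic : ∀ s → 5 + (s + 2) + 11 ≡ 18 + s
  arithmetic = solve-∀
sizeF-Level (suc k) t rewrite sizeT-shiftT (shiftT t) | sizeT-shiftT t = begin
  3 + (L + (4 + (sizeT t + 2) + L)) + 11 ≡⟨ arithmetic L (sizeT t) ⟩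
  (L + 10) + (L + 10) + sizeT t          ≡⟨ cong (λ x → x + x + sizeT t) L+10 ⟩
  18 * 2 ^ k + 18 * 2 ^ k + sizeT t      ≡⟨ doubling (2 ^ k) (sizeT t) ⟩
  18 * 2 ^ suc k + sizeT t               ∎
  where
  open ≡-Reasoning
  L = sizeF (Level k (bvar 0))
  L+10 : L + 10 ≡ 18 * 2 ^ k
  L+10 = suc-injective (trans (sym (+-suc L 10)) (trans (sizeF-Level k (bvar 0)) (+-comm (18 * 2 ^ k) 1)))
  arithmetic : ∀ l s → 3 + (l + (4 + (s + 2) + l)) + 11 ≡ (l + 10) + (l + 10) + s
  arithmetic = solve-∀
  doubling : ∀ p s → 18 * p + 18 * p + s ≡ 18 * (2 * p) + s
  doubling = solve-∀

sizeF-HasTower : ∀ m t → sizeF (HasTower m t) ≡ 5 + 7 * m + sizeT t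
sizeF-HasTower zero t rewrite sizeT-shiftT t = arithmetic (sizeT t)
  where
  arithmetic : ∀ s → 3 + (s + 2) ≡ 5 + 7 * 0 + s
  arithmetic = solve-∀
sizeF-HasTower (suc m) t rewrite sizeT-shiftT t | sizeF-HasTower m (bvar 0) = arithmetic m (sizeT t)
  where
  arithmetic : ∀ m s → 3 + (1 + (s + 2) + (5 + 7 * m + 1)) ≡ 5 + 7 * suc m + s
  arithmetic = solve-∀

sizeFs-axiomCopies : ∀ m → sizeFs (axiomCopies m) ≡ m * 30
sizeFs-axiomCopies zero    = refl
sizeFs-axiomCopies (suc m) = cong (30 +_) (sizeFs-axiomCopies m)

towerProofHeight≡ : ∀ m → towerProofHeight m ≡ 30 + m * 11
towerProofHeight≡ zero    = refl
towerProofHeight≡ (suc m) = trans (cong (11 +_) (towerProofHeight≡ m)) (+-exchange 11 30 (m * 11))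

-- One summand each for the end sequent, the conclusion of the cut and its two
-- premises, whose tame proofs have heights 39 and 30 + 11 d.
proofSizeFactor : ℕ
proofSizeFactor = 200 + 200 + 5 ^ 39 * 200 + 5 ^ 30 * 200

polyBounded : ∀ {g : ℕ → ℕ} c e → (∀ i → g i ≤ c * suc i ^ e) → PolyBounded g
polyBounded c e g≤ = c + e , λ i → ≤-trans (g≤ i) (*-mono-≤ (m≤m+n c e) (^-monoʳ-≤ (suc i) (m≤n+m e c)))

-- P stands for suc i; keeping it a variable stops Agda from unfolding the powers of suc i.
module _ (i P : ℕ) (suc-i≡P : suc i ≡ P) where

  private
    d = exponent i

    instance
      P-nonZero : NonZero P
      P-nonZero = subst NonZero suc-i≡P _

    ≤*P : ∀ c → c ≤ c * P
    ≤*P c = m≤m*n c P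

    +-≤*P : ∀ {x y} a b → x ≤ a * P → y ≤ b * P → x + y ≤ (a + b) * P
    +-≤*P a b x≤ y≤ = ≤-trans (+-mono-≤ x≤ y≤) (≤-reflexive (sym (*-distribʳ-+ P a b)))

  2^exponent≤P : 2 ^ d ≤ P
  2^exponent≤P = subst (2 ^ d ≤_) suc-i≡P (2^exponent≤ i)

  exponent< : d < P
  exponent< = <-≤-trans (n<2^n d) 2^exponent≤P

  sizeF-Level≤ : sizeF (Level d 𝟎) ≤ 19 * P
  sizeF-Level≤ = begin
    sizeF (Level d 𝟎)      ≤⟨ m≤m+n _ 11 ⟩
    sizeF (Level d 𝟎) + 11 ≡⟨ sizeF-Level d 𝟎 ⟩
    18 * 2 ^ d + 1         ≤⟨ +-≤*P 18 1 (*-monoʳ-≤ 18 2^exponent≤P) (≤*P 1) ⟩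
    19 * P                 ∎
    where open ≤-Reasoning

  sizeF-HasTower≤ : sizeF (HasTower d 𝟎) ≤ 13 * P
  sizeF-HasTower≤ = begin
    sizeF (HasTower d 𝟎) ≡⟨ sizeF-HasTower d 𝟎 ⟩
    5 + 7 * d + 1        ≡⟨ +-comm (5 + 7 * d) 1 ⟩
    6 + 7 * d            ≤⟨ +-≤*P 6 7 (≤*P 6) (*-monoʳ-≤ 7 (<⇒≤ exponent<)) ⟩
    13 * P               ∎
    where open ≤-Reasoning

  sizeFs-axiomCopies≤ : ∀ {m} → m ≤ P → sizeFs (axiomCopies m) ≤ 30 * P
  sizeFs-axiomCopies≤ {m} m≤P = begin
    sizeFs (axiomCopies m) ≡⟨ sizeFs-axiomCopies m ⟩
    m * 30                 ≤⟨ *-monoˡ-≤ 30 m≤P ⟩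
    P * 30                 ≡⟨ *-comm P 30 ⟩
    30 * P                 ∎
    where open ≤-Reasoning

  sizeF-closureAxiom≤ : sizeF (closureAxiom d) ≤ 77 * P
  sizeF-closureAxiom≤ = begin
    sizeF (closureAxiom d)                          ≡⟨ sizeF-closeAll (matrixVariables d) (M ⇒ᶠ M) ⟩
    2 * length (matrixVariables d) + suc (sizeF M + sizeF M)
      ≤⟨ +-mono-≤ (*-monoʳ-≤ 2 length≤) (s≤s (+-mono-≤ M≤ M≤)) ⟩
    2 * (19 * P) + suc (19 * P + 19 * P)            ≤⟨ arithmetic ⟩
    77 * P                                          ∎
    where
    open ≤-Reasoning
    M = matrixLevel d
    M≤ : sizeF M ≤ 19 * P
    M≤ = ≤-trans (proj₁ (proj₂ (MatrixOf-Level d))) sizeF-Level≤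
    length≤ : length (matrixVariables d) ≤ 19 * P
    length≤ = ≤-trans (length-deduplicate _≟_ (fvF M)) (≤-trans (length-fvF M) M≤)
    arithmetic : 2 * (19 * P) + suc (19 * P + 19 * P) ≤ 77 * P
    arithmetic = ≤-trans (+-monoʳ-≤ (2 * (19 * P)) (+-monoˡ-≤ (19 * P + 19 * P) (≤*P 1)))
                         (≤-reflexive (identity P))
      where
      identity : ∀ P → 2 * (19 * P) + (1 * P + (19 * P + 19 * P)) ≡ 77 * P
      identity = solve-∀

  private
    sequent≤ : ∀ Γ D a b → sizeFs Γ ≤ a * P → sizeF D ≤ b * P → a + b ≤ 199 → sizeS (Γ ⊢ [ D ]) ≤ 200 * P
    sequent≤ Γ D a b Γ≤ D≤ a+b≤ = begin
      suc (sizeFs Γ + (sizeF D + 0)) ≡⟨ cong (λ x → suc (sizeFs Γ + x)) (+-identityʳ (sizeF D)) ⟩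
      suc (sizeFs Γ + sizeF D)       ≤⟨ +-mono-≤ (≤*P 1) (+-≤*P a b Γ≤ D≤) ⟩
      1 * P + (a + b) * P            ≤⟨ +-monoʳ-≤ (1 * P) (*-monoˡ-≤ P a+b≤) ⟩
      1 * P + 199 * P                ≡⟨ *-distribʳ-+ P 1 199 ⟨
      200 * P                        ∎
      where open ≤-Reasoning

  sizeS-Sequent≤ : sizeS (Sequent i) ≤ 200 * P
  sizeS-Sequent≤ = sequent≤ (closureAxiom d ∷ axiomCopies (suc d)) (HasTower d 𝟎) 107 13
    (+-≤*P 77 30 sizeF-closureAxiom≤ (sizeFs-axiomCopies≤ exponent<)) sizeF-HasTower≤ (≤ᵇ⇒≤ 120 199 tt)

  sizeS-cut≤ : sizeS (axiomCopies (suc d) ⊢ [ HasTower d 𝟎 ]) ≤ 200 * P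
  sizeS-cut≤ = sequent≤ (axiomCopies (suc d)) (HasTower d 𝟎) 30 13
    (sizeFs-axiomCopies≤ exponent<) sizeF-HasTower≤ (≤ᵇ⇒≤ 43 199 tt)

  sizeS-level≤ : sizeS (Axioms ⊢ [ Level d 𝟎 ]) ≤ 200 * P
  sizeS-level≤ = sequent≤ Axioms (Level d 𝟎) 30 19 (≤*P 30) sizeF-Level≤ (≤ᵇ⇒≤ 49 199 tt)

  sizeS-tower≤ : sizeS (Level d 𝟎 ∷ axiomCopies d ⊢ [ HasTower d 𝟎 ]) ≤ 200 * P
  sizeS-tower≤ = sequent≤ (Level d 𝟎 ∷ axiomCopies d) (HasTower d 𝟎) 49 13
    (+-≤*P 19 30 sizeF-Level≤ (sizeFs-axiomCopies≤ (<⇒≤ exponent<))) sizeF-HasTower≤ (≤ᵇ⇒≤ 62 199 tt)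

  5^towerProofHeight≤ : 5 ^ towerProofHeight d ≤ 5 ^ 30 * P ^ 33
  5^towerProofHeight≤ = subst (_≤ 5 ^ 30 * P ^ 33) (cong (5 ^_) (sym (towerProofHeight≡ d))) (5^[a+d*11]≤ 30)
    where
    open ≤-Reasoning
    arithmetic : ∀ d → 3 * (d * 11) ≡ d * 33
    arithmetic = solve-∀
    -- With a variable exponent a, Agda never unfolds a multiplication by the literal 5 ^ 30.
    5^[a+d*11]≤ : ∀ a → 5 ^ (a + d * 11) ≤ 5 ^ a * P ^ 33
    5^[a+d*11]≤ a = begin
      5 ^ (a + d * 11)          ≡⟨ ^-distribˡ-+-* 5 a (d * 11) ⟩
      5 ^ a * 5 ^ (d * 11)      ≤⟨ *-monoʳ-≤ (5 ^ a) (^-monoˡ-≤ (d * 11) (≤ᵇ⇒≤ 5 (2 ^ 3) tt)) ⟩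
      5 ^ a * (2 ^ 3) ^ (d * 11) ≡⟨ cong (5 ^ a *_) (trans (^-*-assoc 2 3 (d * 11)) (cong (2 ^_) (arithmetic d))) ⟩
      5 ^ a * 2 ^ (d * 33)      ≡⟨ cong (5 ^ a *_) (^-*-assoc 2 d 33) ⟨
      5 ^ a * (2 ^ d) ^ 33      ≤⟨ *-monoʳ-≤ (5 ^ a) (^-monoˡ-≤ 33 2^exponent≤P) ⟩
      5 ^ a * P ^ 33            ∎

  sizeP-proof≤ : sizeP (proof i) ≤ proofSizeFactor * P ^ 34
  sizeP-proof≤ = combine (5 ^ 39) (5 ^ 30) level-bound tower-bound
    where
    level = level-zero d
    towers = tower-proof d
    level-bound : sizeP (proj₁ level) ≤ 5 ^ 39 * (200 * P)
    level-bound = ≤-trans (sizeP-tame (proj₁ level) (proj₁ (proj₂ level)))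
                          (*-mono-≤ (^-monoʳ-≤ 5 (proj₂ (proj₂ level))) sizeS-level≤)
    tower-bound : sizeP (proj₁ towers) ≤ 5 ^ 30 * P ^ 33 * (200 * P)
    tower-bound = ≤-trans (sizeP-tame (proj₁ towers) (proj₁ (proj₂ towers)))
                          (*-mono-≤ (≤-trans (^-monoʳ-≤ 5 (proj₂ (proj₂ towers))) 5^towerProofHeight≤) sizeS-tower≤)
    P≤P^34 : P ≤ P * P ^ 33
    P≤P^34 = m≤m*n P (P ^ 33) {{m^n≢0 P 33}}
    arithmetic : ∀ a b P q → 200 * (P * q) + (200 * (P * q) + a * (200 * (P * q)) + b * q * (200 * P))
                           ≡ (200 + 200 + a * 200 + b * 200) * (P * q)
    arithmetic = solve-∀
    combine : ∀ a b → sizeP (proj₁ level) ≤ a * (200 * P) → sizeP (proj₁ towers) ≤ b * P ^ 33 * (200 * P) →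
              sizeP (proof i) ≤ (200 + 200 + a * 200 + b * 200) * (P * P ^ 33)
    combine a b level≤ tower≤ = begin
      sizeP (proof i)
        ≤⟨ +-mono-≤ sizeS-Sequent≤ (+-mono-≤ (+-mono-≤ sizeS-cut≤ level≤) tower≤) ⟩
      200 * P + (200 * P + a * (200 * P) + b * P ^ 33 * (200 * P))
        ≤⟨ +-mono-≤ (*-monoʳ-≤ 200 P≤P^34) (+-monoˡ-≤ (b * P ^ 33 * (200 * P))
             (+-mono-≤ (*-monoʳ-≤ 200 P≤P^34) (*-monoʳ-≤ a (*-monoʳ-≤ 200 P≤P^34)))) ⟩
      200 * (P * P ^ 33) + (200 * (P * P ^ 33) + a * (200 * (P * P ^ 33)) + b * P ^ 33 * (200 * P))
        ≡⟨ arithmetic a b P (P ^ 33) ⟩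
      (200 + 200 + a * 200 + b * 200) * (P * P ^ 33) ∎
      where open ≤-Reasoning


onlyWeak : ∀ i → OnlyWeak (Sequent i)
onlyWeak i = All⇒AllNoStrong (proj₁ (weak i)) , All⇒AllNoStrong (proj₂ (weak i))

lemma1 : Σ (ℕ → Seq) λ S → Σ ((i : ℕ) → Proof (S i)) λ π →
    PolyBounded (λ i → sizeS (S i))
    × (∀ (f : ETerm) → ¬ (∀ i → Σ (Proof (S i)) λ p → CutFree p × sizeP p ≤ evalE f i))
    × PolyBounded (λ i → sizeP (π i))
    × (∀ i → OnlyWeak (S i))
    × (∀ i A → A ∈ cuts (π i) →
        Σ (List ℕ) λ xs → Unique xs
          × (∀ a → (a ∈ xs) ⇔ (a ∈ fvF (matrix A)))
          × (closeAll xs (matrix A ⇒ᶠ matrix A) ∈ antecedent (S i)))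
lemma1 = Sequent , proof
       , polyBounded 200 1 (λ i → ≤-trans (sizeS-Sequent≤ i (suc i) refl) (*-monoʳ-≤ 200 (m≤m*n (suc i) 1)))
       , no-elementary-bound
       , polyBounded proofSizeFactor 34 (λ i → sizeP-proof≤ i (suc i) refl)
       , onlyWeak
       , cut-closure-in-antecedent
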